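{- Let $\mathbf{X}$, $\mathbf{A}$ be $\sigma$-structures and $k\ge1$. Then $\mathrm{SA}^k(\mathbf{X},\mathbf{A})$ is feasible if and only if $\mathrm{SA}^1(\mathbf{X}^{*_k},\mathbf{A}^{*_k})$ is feasible.
   Context: A $\sigma$-structure $\mathbf{A}$ ($\sigma$ a finite set of relation symbols with arities) is a finite universe $A$ with non-empty relations $R^{\mathbf{A}}\subseteq A^{\operatorname{ar}(R)}$. For a tuple $\mathbf{x}$, $\{\mathbf{x}\}$ is its set of entries; $\mathcal{C}_{\mathbf{A}}$ is the set of formal expressions $R(\mathbf{a})$ with $\mathbf{a}\in R^{\mathbf{A}}$. For $\mathbf{a}\in A^j$ and $\mathbf{i}=(i_1,\dots,i_n)\in[j]^n$, $\pi_{\mathbf{i}}\mathbf{a}=(a_{i_1},\dots,a_{i_n})$. The structure $\mathbf{A}^{*_k}$ has universe $\bigcup_{1\le j\le k}A^j\cup\mathcal{C}_{\mathbf{A}}$ and the following relations: unary $T_{j,S}=\{\mathbf{a}\in A^j: a_i=a_{i'}\ \forall i,i'\in S\}$ for $j\le k$, $S\subseteq[j]$; binary $T_{j,\mathbf{i}}=\{(\mathbf{a},\pi_{\mathbf{i}}\mathbf{a}):\mathbf{a}\in A^j\}$ for $j,j'\le k$, $\mathbf{i}\in[j]^{j'}$; unary $R_S=\{R(\mathbf{a}):\mathbf{a}\in R^{\mathbf{A}}, a_i=a_{i'}\ \forall i,i'\in S\}$ for $R\in\sigma$, $S\subseteq[\operatorname{ar}(R)]$; binary $R_{\mathbf{i}}=\{(R(\mathbf{a}),\pi_{\mathbf{i}}\mathbf{a}):\mathbf{a}\in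 R^{\mathbf{A}}\}$ for $R\in\sigma$, $j\le k$, $\mathbf{i}\in[\operatorname{ar}(R)]^j$. $\mathrm{SA}^k(\mathbf{X},\mathbf{A})$ has variables $p_V(f)\in[0,1]$ for $V\subseteq X$ with $1\le|V|\le k$ and $f:V\to A$, and $p_{R(\mathbf{x})}(f)\in[0,1]$ for $R(\mathbf{x})\in\mathcal{C}_{\mathbf{X}}$ and $f:\{\mathbf{x}\}\to A$, subject to: (i) $\sum_{f:V\to A}p_V(f)=1$ for each such $V$; (ii) $p_U(f)=\sum_{g:V\to A,\,g|_U=f}p_V(g)$ for nonempty $U\subseteq V\subseteq X$ with $|V|\le k$ and $f:U\to A$; (iii) $p_U(f)=\sum_{g:\{\mathbf{x}\}\to A,\,g|_U=f}p_{R(\mathbf{x})}(g)$ for $R(\mathbf{x})\in\mathcal{C}_{\mathbf{X}}$, nonempty $U\subseteq\{\mathbf{x}\}$ with $|U|\le k$, $f:U\to A$; (iv) $p_{R(\mathbf{x})}(f)=0$ whenever $f(\mathbf{x})\notin R^{\mathbf{A}}$. $\mathrm{SA}^1$ is the case $k=1$ (over the signature of the structures involved). Feasible means having a rational solution. -}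

module Defs where

open import Data.Nat using (ℕ; zero; suc; _≤_)
open import Data.Bool using (Bool; true; false; T; if_then_else_; not; _∧_; _∨_)
open import Data.Bool.Properties using (T?)
open import Data.Unit using (tt)
open import Data.Fin using (Fin; toℕ)
import Data.Fin.Properties as FinP
open import Data.Fin.Subset using (Subset; ∣_∣; _⊆_)
open import Data.Vec using (Vec; []; _∷_; zipWith; tabulate)
import Data.Vec as Vec
import Data.Vec.Properties as VecP
open import Data.Maybe using (Maybe; just; nothing; maybe)
import Data.Maybe.Properties as MaybeP
open import Data.List.Base using (List; []; _∷_; [_]; length; map; concatMap; filter; foldr; allFin; _++_)
import Data.List as List
open import Data.List.Membership.Propositional using (_∈_)
open import Data.List.Relation.Unary.Unique.Propositional using (Unique)
open import Data.Product using (Σ; ∃; _×_; _,_)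
open import Data.Rational using (ℚ; 0ℚ; 1ℚ; _+_) renaming (_≤_ to _≤ℚ_)
open import Relation.Binary.PropositionalEquality using (_≡_; refl; cong)
open import Relation.Binary.Definitions using (DecidableEquality)
open import Relation.Nullary using (yes; no; ⌊_⌋)

record Signature : Set₁ where
  field
    Sym : Set
    ar  : Sym → ℕ

record FinSignature (σ : Signature) : Set where
  open Signature σ
  field
    _≟S_          : DecidableEquality Sym
    syms          : List Sym
    syms-complete : ∀ R → R ∈ syms
    syms-unique   : Unique syms

record Structure (σ : Signature) : Set₁ where
  open Signature σ
  field
    U     : Set
    _≟U_  : DecidableEquality U
    elems : List U
    rel   : (R : Sym) → Vec U (ar R) → Bool

record IsFinStructure {σ : Signature} (A : Structure σ) : Set where
  open Signature σ
  open Structure A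
  field
    elems-complete : ∀ a → a ∈ elems
    elems-unique   : Unique elems
    rel-nonempty   : ∀ R → ∃ λ (a : Vec U (ar R)) → T (rel R a)

sumℚ : List ℚ → ℚ
sumℚ = foldr _+_ 0ℚ

allVecs : {B : Set} → List B → (m : ℕ) → List (Vec B m)
allVecs bs zero    = [ [] ]
allVecs bs (suc m) = concatMap (λ b → map (b ∷_) (allVecs bs m)) bs

allᵇ : {B : Set} → (B → Bool) → List B → Bool
allᵇ p []       = true
allᵇ p (x ∷ xs) = p x ∧ allᵇ p xs

allEqOn : {B : Set} → DecidableEquality B → ∀ {m} → Subset m → Vec B m → Bool
allEqOn _≟_ {m} S a =
  allᵇ (λ i → allᵇ (λ i' → not (Vec.lookup S i ∧ Vec.lookup S i') ∨ ⌊ Vec.lookup a i ≟ Vec.lookup a i' ⌋)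
                 (allFin m))
      (allFin m)

proj : {B : Set} → ∀ {j j'} → Vec (Fin j) j' → Vec B j → Vec B j'
proj is a = Vec.map (Vec.lookup a) is

T-irr : ∀ {b} (x y : T b) → x ≡ y
T-irr {true} tt tt = refl

-- Convention: a subset V ⊆ X is a mask 'Subset n' over the enumeration
-- 'elems' of X (n = its length); a map f : V → A is represented by the
-- partial map 'Vec (Maybe (U A)) n' whose domain is exactly V (position
-- i ↦ just (f x_i) if x_i ∈ V, nothing otherwise).  'funsOn V' lists all
-- maps V → A.

module SAdefs {σ : Signature} (X A : Structure σ) where
  open Signature σ
  private
    module X = Structure X
    module A = Structure A

  n : ℕ
  n = length X.elems

  PMap : Set
  PMap = Vec (Maybe A.U) n

  _≟P_ : DecidableEquality PMap
  _≟P_ = VecP.≡-dec (MaybeP.≡-dec A._≟U_)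

  funsOn : ∀ {m} → Subset m → List (Vec (Maybe A.U) m)
  funsOn []          = [ [] ]
  funsOn (false ∷ V) = map (nothing ∷_) (funsOn V)
  funsOn (true ∷ V)  = concatMap (λ a → map (just a ∷_) (funsOn V)) A.elems

  restrict : ∀ {m} → Subset m → Vec (Maybe A.U) m → Vec (Maybe A.U) m
  restrict = zipWith (λ b v → if b then v else nothing)

  occurs : ∀ {m} → X.U → Vec X.U m → Bool
  occurs y []       = false
  occurs y (x ∷ xs) = ⌊ y X.≟U x ⌋ ∨ occurs y xs

  support : ∀ {m} → Vec X.U m → Subset n
  support x = tabulate (λ i → occurs (List.lookup X.elems i) x)

  evalAt : (xs : List X.U) → Vec (Maybe A.U) (length xs) → X.U → Maybe A.U
  evalAt []       []       y = nothing
  evalAt (x ∷ xs) (v ∷ vs) y = if ⌊ x X.≟U y ⌋ then v else evalAt xs vs y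

  applyT : ∀ {m} → PMap → Vec X.U m → Maybe (Vec A.U m)
  applyT g []       = just []
  applyT g (x ∷ xs) with evalAt X.elems g x | applyT g xs
  ... | just a  | just as = just (a ∷ as)
  ... | _       | _       = nothing

  sat : (R : Sym) → PMap → Vec X.U (ar R) → Bool
  sat R g x = maybe (A.rel R) false (applyT g x)

  -- A (rational) solution of SA^k(X, A).  p V f stands for p_V(f),
  -- pC R x g for p_{R(x)}(g).
  record SASolution (k : ℕ) : Set where
    field
      p  : Subset n → PMap → ℚ
      pC : (R : Sym) → Vec X.U (ar R) → PMap → ℚ
      p-range  : ∀ V → 1 ≤ ∣ V ∣ → ∣ V ∣ ≤ k → ∀ f → f ∈ funsOn V →
                 0ℚ ≤ℚ p V f × p V f ≤ℚ 1ℚ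
      pC-range : ∀ R x → T (X.rel R x) → ∀ g → g ∈ funsOn (support x) →
                 0ℚ ≤ℚ pC R x g × pC R x g ≤ℚ 1ℚ
      normalised : ∀ V → 1 ≤ ∣ V ∣ → ∣ V ∣ ≤ k →
                   sumℚ (map (p V) (funsOn V)) ≡ 1ℚ
      marginal : ∀ U V → 1 ≤ ∣ U ∣ → U ⊆ V → ∣ V ∣ ≤ k →
                 ∀ f → f ∈ funsOn U →
                 p U f ≡ sumℚ (map (p V) (filter (λ g → restrict U g ≟P f) (funsOn V)))
      marginalC : ∀ R x → T (X.rel R x) →
                  ∀ U → 1 ≤ ∣ U ∣ → U ⊆ support x → ∣ U ∣ ≤ k →
                  ∀ f → f ∈ funsOn U →
                  p U f ≡ sumℚ (map (pC R x) (filter (λ g → restrict U g ≟P f)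
                                                     (funsOn (support x))))
      respects : ∀ R x → T (X.rel R x) → ∀ g → g ∈ funsOn (support x) →
                 sat R g x ≡ false → pC R x g ≡ 0ℚ

open SAdefs public using (SASolution)

SA-feasible : {σ : Signature} → ℕ → Structure σ → Structure σ → Set
SA-feasible k X A = SAdefs.SASolution X A k

-- Lengths j with 1 ≤ j ≤ k are encoded by 'Fin k' via j ↦ suc (toℕ j).

len : ∀ {k} → Fin k → ℕ
len j = suc (toℕ j)

module StarDefs {σ : Signature} (Fσ : FinSignature σ) (k : ℕ) where
  open Signature σ
  open FinSignature Fσ

  data StarSym : Set where
    TS : (j : Fin k) → Subset (len j) → StarSym
    Ti : (j j' : Fin k) → Vec (Fin (len j)) (len j') → StarSym
    RS : (R : Sym) → Subset (ar R) → StarSym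
    Ri : (R : Sym) (j : Fin k) → Vec (Fin (ar R)) (len j) → StarSym

  starAr : StarSym → ℕ
  starAr (TS _ _)   = 1
  starAr (Ti _ _ _) = 2
  starAr (RS _ _)   = 1
  starAr (Ri _ _ _) = 2

  σ* : Signature
  σ* = record { Sym = StarSym ; ar = starAr }

  module _ (A : Structure σ) where
    open Structure A

    data Star : Set where
      tup : (j : Fin k) → Vec U (len j) → Star
      con : (R : Sym) (a : Vec U (ar R)) → T (rel R a) → Star

    _≟*_ : DecidableEquality Star
    tup j a ≟* tup j' b with j FinP.≟ j'
    ... | no ¬p = no λ { refl → ¬p refl }
    ... | yes refl with VecP.≡-dec _≟U_ a b
    ...   | yes refl = yes refl
    ...   | no ¬q    = no λ { refl → ¬q refl }
    tup _ _ ≟* con _ _ _ = no λ ()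
    con _ _ _ ≟* tup _ _ = no λ ()
    con R a t ≟* con R' b t' with R ≟S R'
    ... | no ¬p = no λ { refl → ¬p refl }
    ... | yes refl with VecP.≡-dec _≟U_ a b
    ...   | yes refl = yes (cong (con R a) (T-irr t t'))
    ...   | no ¬q    = no λ { refl → ¬q refl }

    conList : (R : Sym) → List (Vec U (ar R)) → List Star
    conList R []       = []
    conList R (a ∷ as) with T? (rel R a)
    ... | yes t = con R a t ∷ conList R as
    ... | no _  = conList R as

    starElems : List Star
    starElems = concatMap (λ j → map (tup j) (allVecs elems (len j))) (allFin k)
             ++ concatMap (λ R → conList R (allVecs elems (ar R))) syms

    starRel : (S : StarSym) → Vec Star (starAr S) → Bool
    starRel (TS j S) (tup j₁ a ∷ []) with j FinP.≟ j₁
    ... | yes refl = allEqOn _≟U_ S a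
    ... | no _     = false
    starRel (TS j S) (con _ _ _ ∷ []) = false
    starRel (Ti j j' is) (tup j₁ a ∷ tup j₂ b ∷ []) with j FinP.≟ j₁ | j' FinP.≟ j₂
    ... | yes refl | yes refl = ⌊ VecP.≡-dec _≟U_ b (proj is a) ⌋
    ... | _        | _        = false
    starRel (Ti j j' is) (_ ∷ _ ∷ []) = false
    starRel (RS R S) (con R₁ a _ ∷ []) with R ≟S R₁
    ... | yes refl = allEqOn _≟U_ S a
    ... | no _     = false
    starRel (RS R S) (tup _ _ ∷ []) = false
    starRel (Ri R j is) (con R₁ a _ ∷ tup j₂ b ∷ []) with R ≟S R₁ | j FinP.≟ j₂
    ... | yes refl | yes refl = ⌊ VecP.≡-dec _≟U_ b (proj is a) ⌋
    ... | _        | _        = false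
    starRel (Ri R j is) (_ ∷ _ ∷ []) = false

    star : Structure σ*
    star = record { U = Star ; _≟U_ = _≟*_ ; elems = starElems ; rel = starRel }

starStructure : {σ : Signature} (Fσ : FinSignature σ) (k : ℕ) →
                Structure σ → Structure (StarDefs.σ* Fσ k)
starStructure Fσ k A = StarDefs.star Fσ k A

-- Both sides are rewritten in tuple coordinates: a solution is a family of distributions μ x on A^m,
-- one for each x ∈ X^m with 1 ≤ m ≤ k, supported on the tuples consistent with x, together with
-- distributions ν R x on R^A for the constraints R(x), all compatible under the projections π_i.
-- For SA^k(X, A) this is a change of variables, since a map {x} → A is the same as a tuple consistent
-- with x. A tuple solution of level k on (X, A) in turn is the same as one of level 1 on (X^{*k}, A^{*k}):
-- the elements tup j x and R(x) of X^{*k} carry μ x and ν R x, the unary relations T_{j,S} and R_S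
-- express consistency, and the binary relations T_{j,i} and R_i express compatibility with π_i.

module Submission where

open import Defs
open import Data.Nat using (ℕ; _≤_)
open import Function.Bundles using (_⇔_)

open import Algebra.Bundles using (CommutativeMonoid)
open import Data.Bool using (Bool; true; false; T; if_then_else_; not; _∧_; _∨_)
open import Data.Bool.Properties using (T?)
open import Data.Empty using (⊥; ⊥-elim)
open import Data.Fin using (Fin; zero; suc; toℕ; fromℕ<)
import Data.Fin.Properties as FinP
open import Data.Fin.Subset using (Subset; ∣_∣; _⊆_)
import Data.Fin.Subset as Subset
import Data.Fin.Subset.Properties as SubsetP
open import Data.List.Base as List using (List; []; _∷_; map; filter; concatMap; _++_; length; allFin)
open import Data.List.Membership.Propositional using (_∈_; find)
open import Data.List.Membership.Propositional.Properties
import Data.List.Relation.Unary.All as All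
import Data.List.Relation.Unary.AllPairs as AllPairs
open import Data.List.Relation.Unary.Any as Any using (here; there)
import Data.List.Relation.Unary.Any.Properties as AnyP
open import Data.List.Relation.Unary.Unique.Propositional using (Unique)
import Data.List.Relation.Unary.Unique.Propositional.Properties as UniqueP
open import Data.Maybe using (Maybe; just; nothing; maybe)
open import Data.Maybe.Properties as MaybeP using (just-injective)
open import Data.Nat using (zero; suc; z≤n; s≤s)
import Data.Nat.Properties as ℕP
open import Data.Product using (Σ; Σ-syntax; ∃; _×_; _,_; proj₁; proj₂)
open import Data.Rational using (ℚ; 0ℚ; 1ℚ; _+_) renaming (_≤_ to _≤ℚ_)
import Data.Rational.Properties as ℚP
open import Data.Sum using (_⊎_; inj₁; inj₂)
open import Data.Unit using (⊤; tt)
open import Data.Vec as Vec using (Vec; []; _∷_)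
import Data.Vec.Properties as VecP
open import Function using (_∘_)
open import Function.Bundles using (mk⇔)
open import Relation.Binary.Definitions using (DecidableEquality)
open import Relation.Binary.PropositionalEquality
open import Relation.Nullary
open import Relation.Nullary.Decidable using (_→-dec_)
open import Relation.Unary using (Pred; Decidable)

open import Algebra.Properties.CommutativeSemigroup (CommutativeMonoid.commutativeSemigroup ℚP.+-0-commutativeMonoid)
  using (interchange)

-- Sums over lists

∑ : {B : Set} → List B → (B → ℚ) → ℚ
∑ l f = sumℚ (map f l)

when : {P : Set} → Dec P → ℚ → ℚ
when d q = if does d then q else 0ℚ

when-yes : {P : Set} (d : Dec P) (q : ℚ) → P → when d q ≡ q
when-yes (yes _) q _ = refl
when-yes (no ¬p) q p = ⊥-elim (¬p p)

when-no : {P : Set} (d : Dec P) (q : ℚ) → ¬ P → when d q ≡ 0ℚ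
when-no (yes p) q ¬p = ⊥-elim (¬p p)
when-no (no _)  q _  = refl

when-0 : {P : Set} (d : Dec P) → when d 0ℚ ≡ 0ℚ
when-0 (yes _) = refl
when-0 (no _)  = refl

when-cong : {P Q : Set} (d : Dec P) (e : Dec Q) (q : ℚ) → (P → Q) → (Q → P) → when d q ≡ when e q
when-cong (yes _) (yes _) q _ _ = refl
when-cong (yes p) (no ¬q) q f _ = ⊥-elim (¬q (f p))
when-cong (no ¬p) (yes q') q _ g = ⊥-elim (¬p (g q'))
when-cong (no _)  (no _)  q _ _ = refl

when-nonneg : {P : Set} (d : Dec P) {q : ℚ} → 0ℚ ≤ℚ q → 0ℚ ≤ℚ when d q
when-nonneg (yes _) h = h
when-nonneg (no _)  h = ℚP.≤-refl

∑-cong-∈ : {B : Set} (l : List B) {f g : B → ℚ} → (∀ {y} → y ∈ l → f y ≡ g y) → ∑ l f ≡ ∑ l g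
∑-cong-∈ []      h = refl
∑-cong-∈ (x ∷ l) h = cong₂ _+_ (h (here refl)) (∑-cong-∈ l (h ∘ there))

∑-cong : {B : Set} (l : List B) {f g : B → ℚ} → (∀ y → f y ≡ g y) → ∑ l f ≡ ∑ l g
∑-cong l h = ∑-cong-∈ l (λ {y} _ → h y)

∑-zero : {B : Set} (l : List B) {f : B → ℚ} → (∀ {y} → y ∈ l → f y ≡ 0ℚ) → ∑ l f ≡ 0ℚ
∑-zero []      h = refl
∑-zero (x ∷ l) h = cong₂ _+_ (h (here refl)) (∑-zero l (λ m → h (there m)))

∑-0 : {B : Set} (l : List B) → ∑ l (λ _ → 0ℚ) ≡ 0ℚ
∑-0 l = ∑-zero l (λ _ → refl)

∑-++ : {B : Set} (l₁ l₂ : List B) (f : B → ℚ) → ∑ (l₁ ++ l₂) f ≡ ∑ l₁ f + ∑ l₂ f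
∑-++ []       l₂ f = sym (ℚP.+-identityˡ _)
∑-++ (x ∷ l₁) l₂ f = trans (cong (f x +_) (∑-++ l₁ l₂ f)) (sym (ℚP.+-assoc (f x) _ _))

∑-map : {B C : Set} (g : B → C) (l : List B) (f : C → ℚ) → ∑ (map g l) f ≡ ∑ l (λ y → f (g y))
∑-map g []      f = refl
∑-map g (x ∷ l) f = cong (f (g x) +_) (∑-map g l f)

∑-concatMap : {B C : Set} (g : B → List C) (l : List B) (f : C → ℚ) →
              ∑ (concatMap g l) f ≡ ∑ l (λ y → ∑ (g y) f)
∑-concatMap g []      f = refl
∑-concatMap g (x ∷ l) f = trans (∑-++ (g x) (concatMap g l) f) (cong (∑ (g x) f +_) (∑-concatMap g l f))

∑-filter : {B : Set} {P : Pred B _} (P? : Decidable P) (l : List B) (f : B → ℚ) →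
           ∑ (filter P? l) f ≡ ∑ l (λ y → when (P? y) (f y))
∑-filter P? []      f = refl
∑-filter P? (x ∷ l) f with does (P? x)
... | true  = cong (f x +_) (∑-filter P? l f)
... | false = trans (∑-filter P? l f) (sym (ℚP.+-identityˡ _))

∑-+ : {B : Set} (l : List B) (f g : B → ℚ) → ∑ l (λ y → f y + g y) ≡ ∑ l f + ∑ l g
∑-+ []      f g = refl
∑-+ (x ∷ l) f g = trans (cong (f x + g x +_) (∑-+ l f g)) (interchange (f x) (g x) _ _)

∑-comm : {B C : Set} (l₁ : List B) (l₂ : List C) (F : B → C → ℚ) →
         ∑ l₁ (λ a → ∑ l₂ (F a)) ≡ ∑ l₂ (λ b → ∑ l₁ (λ a → F a b))
∑-comm []       l₂ F = sym (∑-0 l₂)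
∑-comm (x ∷ l₁) l₂ F = trans (cong (∑ l₂ (F x) +_) (∑-comm l₁ l₂ F)) (sym (∑-+ l₂ (F x) _))

∑-when : {B P : Set} (l : List B) (d : Dec P) (G : B → ℚ) → ∑ l (λ y → when d (G y)) ≡ when d (∑ l G)
∑-when l (yes _) G = refl
∑-when l (no _)  G = ∑-0 l

∑-nonneg : {B : Set} (l : List B) {f : B → ℚ} → (∀ {y} → y ∈ l → 0ℚ ≤ℚ f y) → 0ℚ ≤ℚ ∑ l f
∑-nonneg []      h = ℚP.≤-refl
∑-nonneg (x ∷ l) h = ℚP.+-mono-≤ (h (here refl)) (∑-nonneg l (λ m → h (there m)))

term≤∑ : {B : Set} (l : List B) {f : B → ℚ} → (∀ {y} → y ∈ l → 0ℚ ≤ℚ f y) →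
         ∀ {e} → e ∈ l → f e ≤ℚ ∑ l f
term≤∑ (x ∷ l) {f} h (here refl) = begin
  f x          ≡⟨ ℚP.+-identityʳ (f x) ⟨
  f x + 0ℚ     ≤⟨ ℚP.+-monoʳ-≤ (f x) (∑-nonneg l (λ m → h (there m))) ⟩
  ∑ (x ∷ l) f  ∎
  where open ℚP.≤-Reasoning
term≤∑ (x ∷ l) {f} h {e} (there m) = begin
  f e          ≡⟨ ℚP.+-identityˡ (f e) ⟨
  0ℚ + f e     ≤⟨ ℚP.+-mono-≤ (h (here refl)) (term≤∑ l (λ m' → h (there m')) m) ⟩
  ∑ (x ∷ l) f  ∎
  where open ℚP.≤-Reasoning

∑-single : {B : Set} (l : List B) {f : B → ℚ} {e : B} → Unique l → e ∈ l →
           (∀ {y} → y ∈ l → y ≢ e → f y ≡ 0ℚ) → ∑ l f ≡ f e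
∑-single (x ∷ l) {f} (x∉l AllPairs.∷ _) (here refl) h =
  trans (cong (f x +_) (∑-zero l (λ m → h (there m) (λ { refl → All.lookup x∉l m refl }))))
        (ℚP.+-identityʳ _)
∑-single (x ∷ l) {f} (x∉l AllPairs.∷ u) (there m) h =
  trans (cong₂ _+_ (h (here refl) (λ { refl → All.lookup x∉l m refl })) (∑-single l u m (h ∘ there)))
        (ℚP.+-identityˡ _)

∑-fibres : {B C : Set} (l₁ : List B) (l₂ : List C) (R : B → C → Set) (R? : ∀ a b → Dec (R a b)) →
           Unique l₂ →
           (∀ {a} → a ∈ l₁ → Σ[ b ∈ C ] (b ∈ l₂ × R a b × (∀ {b'} → b' ∈ l₂ → R a b' → b' ≡ b))) →
           (f : B → ℚ) → ∑ l₁ f ≡ ∑ l₂ (λ b → ∑ l₁ (λ a → when (R? a b) (f a)))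
∑-fibres l₁ l₂ R R? u h f = trans (∑-cong-∈ l₁ split) (∑-comm l₁ l₂ (λ a b → when (R? a b) (f a)))
  where
    split : ∀ {a} → a ∈ l₁ → f a ≡ ∑ l₂ (λ b → when (R? a b) (f a))
    split {a} m with h m
    ... | b , b∈ , r , unique =
      sym (trans (∑-single l₂ u b∈ (λ b'∈ b'≢b → when-no (R? a _) (f a) (λ r' → b'≢b (unique b'∈ r'))))
                 (when-yes (R? a b) (f a) r))

concatMap-unique : {B C : Set} (f : B → List C) (l : List B) → Unique l → (∀ a → Unique (f a)) →
                   (∀ {a a' c} → c ∈ f a → c ∈ f a' → a ≡ a') → Unique (concatMap f l)
concatMap-unique f []      _                   _  _      = AllPairs.[]
concatMap-unique f (x ∷ l) (x∉l AllPairs.∷ u) uf fibres =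
  UniqueP.++⁺ (uf x) (concatMap-unique f l u uf fibres) disjoint
  where
    disjoint : ∀ {c} → ¬ (c ∈ f x × c ∈ concatMap f l)
    disjoint (c∈fx , c∈rest) with find (∈-concatMap⁻ f {xs = l} c∈rest)
    ... | a , a∈l , c∈fa = All.lookup x∉l a∈l (fibres c∈fx c∈fa)

∈-allVecs : {B : Set} (l : List B) → (∀ a → a ∈ l) → ∀ {m} (b : Vec B m) → b ∈ allVecs l m
∈-allVecs l complete []      = here refl
∈-allVecs l complete (a ∷ b) = ∈-concatMap⁺ (λ a' → map (a' ∷_) (allVecs l _)) {xs = l}
  (Any.map (λ { refl → ∈-map⁺ (a ∷_) (∈-allVecs l complete b) }) (complete a))

allVecs-unique : {B : Set} (l : List B) → Unique l → ∀ m → Unique (allVecs l m)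
allVecs-unique l u zero    = All.[] AllPairs.∷ AllPairs.[]
allVecs-unique l u (suc m) =
  concatMap-unique (λ a → map (a ∷_) (allVecs l m)) l u
    (λ a → UniqueP.map⁺ VecP.∷-injectiveʳ (allVecs-unique l u m)) same-head
  where
    same-head : ∀ {a a' c} → c ∈ map (a ∷_) (allVecs l m) → c ∈ map (a' ∷_) (allVecs l m) → a ≡ a'
    same-head m₁ m₂ with ∈-map⁻ _ m₁ | ∈-map⁻ _ m₂
    ... | _ , _ , refl | _ , _ , e = VecP.∷-injectiveˡ e

∑-allVecs-1 : {B : Set} (l : List B) (F : Vec B 1 → ℚ) → ∑ (allVecs l 1) F ≡ ∑ l (λ c → F (c ∷ []))
∑-allVecs-1 l F = trans (∑-concatMap _ l F) (∑-cong l (λ c → ℚP.+-identityʳ _))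

∑-allVecs-2 : {B : Set} (l : List B) (F : Vec B 2 → ℚ) →
              ∑ (allVecs l 2) F ≡ ∑ l (λ c → ∑ l (λ d → F (c ∷ d ∷ [])))
∑-allVecs-2 l F = trans (∑-concatMap _ l F)
  (∑-cong l (λ c → trans (∑-map (c ∷_) (allVecs l 1) F) (∑-allVecs-1 l (λ v → F (c ∷ v)))))

lookup-injective : {B : Set} (l : List B) → Unique l → ∀ i j → List.lookup l i ≡ List.lookup l j → i ≡ j
lookup-injective (x ∷ l) u                   zero    zero    e = refl
lookup-injective (x ∷ l) (x∉l AllPairs.∷ u) zero    (suc j) e = ⊥-elim (All.lookup x∉l (∈-lookup {xs = l} j) e)
lookup-injective (x ∷ l) (x∉l AllPairs.∷ u) (suc i) zero    e = ⊥-elim (All.lookup x∉l (∈-lookup {xs = l} i) (sym e))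
lookup-injective (x ∷ l) (x∉l AllPairs.∷ u) (suc i) (suc j) e = cong suc (lookup-injective l u i j e)

lookup-ext : {B : Set} {m : ℕ} {u v : Vec B m} → (∀ i → Vec.lookup u i ≡ Vec.lookup v i) → u ≡ v
lookup-ext {u = u} {v} h =
  trans (sym (VecP.tabulate∘lookup u)) (trans (VecP.tabulate-cong h) (VecP.tabulate∘lookup v))

proj-lookup : {B : Set} {m m' : ℕ} (is : Vec (Fin m) m') (x : Vec B m) (t : Fin m') →
              Vec.lookup (proj is x) t ≡ Vec.lookup x (Vec.lookup is t)
proj-lookup is x t = VecP.lookup-map t (Vec.lookup x) is

bool-cases : (b : Bool) → b ≡ true ⊎ b ≡ false
bool-cases true  = inj₁ refl
bool-cases false = inj₂ refl

⊆-intro : ∀ {n} {p q : Subset n} → (∀ i → Vec.lookup p i ≡ true → Vec.lookup q i ≡ true) → p ⊆ q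
⊆-intro {p = p} {q} h {i} i∈p = VecP.lookup⇒[]= i q (h i (VecP.[]=⇒lookup i∈p))

⊆-elim : ∀ {n} {p q : Subset n} → p ⊆ q → ∀ i → Vec.lookup p i ≡ true → Vec.lookup q i ≡ true
⊆-elim {p = p} p⊆q i e = VecP.[]=⇒lookup (p⊆q (VecP.lookup⇒[]= i p e))

∣p∣≡0 : ∀ {n} (p : Subset n) → (∀ i → Vec.lookup p i ≢ true) → ∣ p ∣ ≡ 0
∣p∣≡0 []          h = refl
∣p∣≡0 (true ∷ p)  h = ⊥-elim (h zero refl)
∣p∣≡0 (false ∷ p) h = ∣p∣≡0 p (h ∘ suc)

1≤∣p∣ : ∀ {n} (p : Subset n) i → Vec.lookup p i ≡ true → 1 ≤ ∣ p ∣
1≤∣p∣ (true ∷ p)  i       e = s≤s z≤n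
1≤∣p∣ (false ∷ p) (suc i) e = 1≤∣p∣ p i e

∣b∷p∣≤1+∣p∣ : ∀ {n} b (p : Subset n) → ∣ b ∷ p ∣ ≤ suc ∣ p ∣
∣b∷p∣≤1+∣p∣ true  p = ℕP.≤-refl
∣b∷p∣≤1+∣p∣ false p = ℕP.n≤1+n _

∣p∣≤1+∣q∣ : ∀ {n} (p q : Subset n) j →
            (∀ i → Vec.lookup p i ≡ true → i ≡ j ⊎ Vec.lookup q i ≡ true) → ∣ p ∣ ≤ suc ∣ q ∣
∣p∣≤1+∣q∣ (b ∷ p) (c ∷ q) zero h = begin
  ∣ b ∷ p ∣      ≤⟨ ∣b∷p∣≤1+∣p∣ b p ⟩
  suc ∣ p ∣      ≤⟨ s≤s (SubsetP.p⊆q⇒∣p∣≤∣q∣ (⊆-intro {p = p} {q} tail)) ⟩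
  suc ∣ q ∣      ≤⟨ s≤s (SubsetP.∣p∣≤∣x∷p∣ c q) ⟩
  suc ∣ c ∷ q ∣  ∎
  where
    open ℕP.≤-Reasoning
    tail : ∀ i → Vec.lookup p i ≡ true → Vec.lookup q i ≡ true
    tail i e with h (suc i) e
    ... | inj₂ e' = e'
∣p∣≤1+∣q∣ (b ∷ p) (c ∷ q) (suc j) h = step b c head (∣p∣≤1+∣q∣ p q j tail)
  where
    tail : ∀ i → Vec.lookup p i ≡ true → i ≡ j ⊎ Vec.lookup q i ≡ true
    tail i e with h (suc i) e
    ... | inj₁ refl = inj₁ refl
    ... | inj₂ e'   = inj₂ e'
    head : b ≡ true → c ≡ true
    head e with h zero e
    ... | inj₂ e' = e'
    step : ∀ b c → (b ≡ true → c ≡ true) → ∣ p ∣ ≤ suc ∣ q ∣ → ∣ b ∷ p ∣ ≤ suc ∣ c ∷ q ∣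
    step true  true  _ le = s≤s le
    step true  false f le with f refl
    ... | ()
    step false true  _ le = ℕP.m≤n⇒m≤1+n le
    step false false _ le = le

T-allᵇ⁻ : {B : Set} (p : B → Bool) (l : List B) → T (allᵇ p l) → ∀ {y} → y ∈ l → T (p y)
T-allᵇ⁻ p (x ∷ l) t (here refl) with p x
... | true = tt
T-allᵇ⁻ p (x ∷ l) t (there m) with p x
... | true = T-allᵇ⁻ p l t m

T-allᵇ⁺ : {B : Set} (p : B → Bool) (l : List B) → (∀ {y} → y ∈ l → T (p y)) → T (allᵇ p l)
T-allᵇ⁺ p []      h = tt
T-allᵇ⁺ p (x ∷ l) h with p x | h (here refl)
... | true | _ = T-allᵇ⁺ p l (h ∘ there)

AllEqOn : {B : Set} {m : ℕ} → Subset m → Vec B m → Set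
AllEqOn S a = ∀ i i' → Vec.lookup S i ≡ true → Vec.lookup S i' ≡ true → Vec.lookup a i ≡ Vec.lookup a i'

allEqOn-sound : {B : Set} (_≟_ : DecidableEquality B) {m : ℕ} (S : Subset m) (a : Vec B m) →
                T (allEqOn _≟_ S a) → AllEqOn S a
allEqOn-sound _≟_ {m} S a t i i' e e' =
  toWitness (lemma (T-allᵇ⁻ _ (allFin m) (T-allᵇ⁻ _ (allFin m) t (∈-allFin i)) (∈-allFin i')))
  where
    lemma : T (not (Vec.lookup S i ∧ Vec.lookup S i') ∨ ⌊ Vec.lookup a i ≟ Vec.lookup a i' ⌋) →
            T ⌊ Vec.lookup a i ≟ Vec.lookup a i' ⌋
    lemma h rewrite e | e' = h

allEqOn-complete : {B : Set} (_≟_ : DecidableEquality B) {m : ℕ} (S : Subset m) (a : Vec B m) →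
                   AllEqOn S a → T (allEqOn _≟_ S a)
allEqOn-complete _≟_ {m} S a h =
  T-allᵇ⁺ _ (allFin m) λ {i} _ → T-allᵇ⁺ _ (allFin m) λ {i'} _ → pointwise i i'
  where
    pointwise : ∀ i i' → T (not (Vec.lookup S i ∧ Vec.lookup S i') ∨ ⌊ Vec.lookup a i ≟ Vec.lookup a i' ⌋)
    pointwise i i' with bool-cases (Vec.lookup S i) | bool-cases (Vec.lookup S i')
    ... | inj₂ e | _ rewrite e = tt
    ... | inj₁ e | inj₂ e' rewrite e | e' = tt
    ... | inj₁ e | inj₁ e' rewrite e | e' = fromWitness (h i i' e e')

-- Partial maps X → A and tuples over A

module TupleCoordinates {σ : Signature} (X A : Structure σ)
  (X-complete : ∀ y → y ∈ Structure.elems X) (X-unique : Unique (Structure.elems X))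
  (A-complete : ∀ a → a ∈ Structure.elems A) (A-unique : Unique (Structure.elems A)) where

  open Signature σ
  module X = Structure X
  module A = Structure A
  open SAdefs X A public

  elemAt : Fin n → X.U
  elemAt = List.lookup X.elems

  indexOf : X.U → Fin n
  indexOf y = Any.index (X-complete y)

  elemAt-indexOf : ∀ y → elemAt (indexOf y) ≡ y
  elemAt-indexOf y = sym (AnyP.lookup-index (X-complete y))

  indexOf-elemAt : ∀ i → indexOf (elemAt i) ≡ i
  indexOf-elemAt i = lookup-injective X.elems X-unique _ _ (elemAt-indexOf (elemAt i))

  _≟V_ : ∀ {m} → DecidableEquality (Vec A.U m)
  _≟V_ = VecP.≡-dec A._≟U_

  _≟M_ : ∀ {m} → DecidableEquality (Maybe (Vec A.U m))
  _≟M_ = MaybeP.≡-dec _≟V_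

  DefinedIff : Bool → Maybe A.U → Set
  DefinedIff true  (just _) = ⊤
  DefinedIff true  nothing  = ⊥
  DefinedIff false (just _) = ⊥
  DefinedIff false nothing  = ⊤

  HasDomain : ∀ {m} → Subset m → Vec (Maybe A.U) m → Set
  HasDomain V g = ∀ i → DefinedIff (Vec.lookup V i) (Vec.lookup g i)

  funsOn-domain : ∀ {m} (V : Subset m) {g} → g ∈ funsOn V → HasDomain V g
  funsOn-domain (false ∷ V) g∈ i with ∈-map⁻ (nothing ∷_) g∈
  funsOn-domain (false ∷ V) g∈ zero    | _ , _  , refl = tt
  funsOn-domain (false ∷ V) g∈ (suc i) | _ , g' , refl = funsOn-domain V g' i
  funsOn-domain (true ∷ V) g∈ i
    with find (∈-concatMap⁻ (λ a → map (just a ∷_) (funsOn V)) {xs = A.elems} g∈)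
  ... | a , _ , a∈ with ∈-map⁻ (just a ∷_) a∈
  funsOn-domain (true ∷ V) g∈ zero    | _ | _ , _  , refl = tt
  funsOn-domain (true ∷ V) g∈ (suc i) | _ | _ , g' , refl = funsOn-domain V g' i

  ∈-funsOn : ∀ {m} (V : Subset m) (g : Vec (Maybe A.U) m) → HasDomain V g → g ∈ funsOn V
  ∈-funsOn []          []           d = here refl
  ∈-funsOn (false ∷ V) (just a ∷ g)  d = ⊥-elim (d zero)
  ∈-funsOn (false ∷ V) (nothing ∷ g) d = ∈-map⁺ (nothing ∷_) (∈-funsOn V g (d ∘ suc))
  ∈-funsOn (true ∷ V)  (nothing ∷ g) d = ⊥-elim (d zero)
  ∈-funsOn (true ∷ V)  (just a ∷ g)  d =
    ∈-concatMap⁺ (λ a → map (just a ∷_) (funsOn V)) {xs = A.elems}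
      (Any.map (λ { refl → ∈-map⁺ (just a ∷_) (∈-funsOn V g (d ∘ suc)) }) (A-complete a))

  funsOn-unique : ∀ {m} (V : Subset m) → Unique (funsOn V)
  funsOn-unique []          = All.[] AllPairs.∷ AllPairs.[]
  funsOn-unique (false ∷ V) = UniqueP.map⁺ VecP.∷-injectiveʳ (funsOn-unique V)
  funsOn-unique (true ∷ V)  =
    concatMap-unique (λ a → map (just a ∷_) (funsOn V)) A.elems A-unique
      (λ a → UniqueP.map⁺ VecP.∷-injectiveʳ (funsOn-unique V)) same-head
    where
      same-head : ∀ {a a' c} → c ∈ map (just a ∷_) (funsOn V) → c ∈ map (just a' ∷_) (funsOn V) → a ≡ a'
      same-head m₁ m₂ with ∈-map⁻ _ m₁ | ∈-map⁻ _ m₂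
      ... | _ , _ , refl | _ , _ , e = just-injective (VecP.∷-injectiveˡ e)

  eval : PMap → X.U → Maybe A.U
  eval g = evalAt X.elems g

  evalAt-lookup : (l : List X.U) → Unique l → (g : Vec (Maybe A.U) (length l)) (i : Fin (length l)) →
                  evalAt l g (List.lookup l i) ≡ Vec.lookup g i
  evalAt-lookup (x ∷ l) u (v ∷ g) zero with x X.≟U x
  ... | yes _ = refl
  ... | no x≢x = ⊥-elim (x≢x refl)
  evalAt-lookup (x ∷ l) (x∉l AllPairs.∷ u) (v ∷ g) (suc i) with x X.≟U List.lookup l i
  ... | yes e = ⊥-elim (All.lookup x∉l (∈-lookup {xs = l} i) e)
  ... | no _  = evalAt-lookup l u g i

  eval-indexOf : ∀ g y → eval g y ≡ Vec.lookup g (indexOf y)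
  eval-indexOf g y = trans (cong (eval g) (sym (elemAt-indexOf y))) (evalAt-lookup X.elems X-unique g (indexOf y))

  applyT-just : ∀ {m} g (x : Vec X.U m) (b : Vec A.U m) →
                (∀ t → eval g (Vec.lookup x t) ≡ just (Vec.lookup b t)) → applyT g x ≡ just b
  applyT-just g []       []       h = refl
  applyT-just g (x ∷ x') (b ∷ b') h rewrite h zero | applyT-just g x' b' (h ∘ suc) = refl

  applyT-just⁻ : ∀ {m} g (x : Vec X.U m) (b : Vec A.U m) → applyT g x ≡ just b →
                 ∀ t → eval g (Vec.lookup x t) ≡ just (Vec.lookup b t)
  applyT-just⁻ g (x ∷ x') (b ∷ b') e t with evalAt X.elems g x in e₁ | applyT g x' in e₂
  applyT-just⁻ g (x ∷ x') (b ∷ b') refl zero    | just a  | just as = e₁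
  applyT-just⁻ g (x ∷ x') (b ∷ b') refl (suc t) | just a  | just as = applyT-just⁻ g x' b' e₂ t
  applyT-just⁻ g (x ∷ x') (b ∷ b') ()   t       | just a  | nothing
  applyT-just⁻ g (x ∷ x') (b ∷ b') ()   t       | nothing | _

  occurs⁻ : ∀ {m} y (x : Vec X.U m) → occurs y x ≡ true → ∃ λ t → Vec.lookup x t ≡ y
  occurs⁻ y (x ∷ x') e with y X.≟U x
  ... | yes refl = zero , refl
  ... | no _ with occurs⁻ y x' e
  ...   | t , e' = suc t , e'

  occurs⁺ : ∀ {m} y (x : Vec X.U m) t → Vec.lookup x t ≡ y → occurs y x ≡ true
  occurs⁺ y (x ∷ x') zero e with y X.≟U x
  ... | yes _ = refl
  ... | no y≢x = ⊥-elim (y≢x (sym e))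
  occurs⁺ y (x ∷ x') (suc t) e with y X.≟U x
  ... | yes _ = refl
  ... | no _  = occurs⁺ y x' t e

  lookup-support : ∀ {m} (x : Vec X.U m) i → Vec.lookup (support x) i ≡ occurs (elemAt i) x
  lookup-support x i = VecP.lookup∘tabulate _ i

  indexOf∈support : ∀ {m} (x : Vec X.U m) t → Vec.lookup (support x) (indexOf (Vec.lookup x t)) ≡ true
  indexOf∈support x t = trans (lookup-support x _) (occurs⁺ _ x t (sym (elemAt-indexOf _)))

  support-proj⊆ : ∀ {m m'} (x : Vec X.U m) (is : Vec (Fin m) m') i →
                  Vec.lookup (support (proj is x)) i ≡ true → Vec.lookup (support x) i ≡ true
  support-proj⊆ x is i e with occurs⁻ (elemAt i) (proj is x) (trans (sym (lookup-support (proj is x) i)) e)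
  ... | t , e' = trans (lookup-support x i) (occurs⁺ (elemAt i) x (Vec.lookup is t) (trans (sym (proj-lookup is x t)) e'))

  ∣support∣≤ : ∀ {m} (x : Vec X.U m) → ∣ support x ∣ ≤ m
  ∣support∣≤ [] = ℕP.≤-reflexive (∣p∣≡0 (support {m = 0} []) λ i e → false≢true (trans (sym (lookup-support {m = 0} [] i)) e))
    where
      false≢true : false ≢ true
      false≢true ()
  ∣support∣≤ (x ∷ x') =
    ℕP.≤-trans (∣p∣≤1+∣q∣ (support (x ∷ x')) (support x') (indexOf x) head-or-tail) (s≤s (∣support∣≤ x'))
    where
      head-or-tail : ∀ i → Vec.lookup (support (x ∷ x')) i ≡ true → i ≡ indexOf x ⊎ Vec.lookup (support x') i ≡ true
      head-or-tail i e with occurs⁻ (elemAt i) (x ∷ x') (trans (sym (lookup-support (x ∷ x') i)) e)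
      ... | zero  , e' = inj₁ (trans (sym (indexOf-elemAt i)) (cong indexOf (sym e')))
      ... | suc t , e' = inj₂ (trans (lookup-support x' i) (occurs⁺ (elemAt i) x' t e'))

  1≤∣support∣ : ∀ {m} (x : Vec X.U (suc m)) → 1 ≤ ∣ support x ∣
  1≤∣support∣ x = 1≤∣p∣ (support x) _ (indexOf∈support x zero)

  -- x ↦ b is the graph of a map {x} → A
  Consistent : ∀ {m} → Vec X.U m → Vec A.U m → Set
  Consistent x b = ∀ t t' → Vec.lookup x t ≡ Vec.lookup x t' → Vec.lookup b t ≡ Vec.lookup b t'

  consistent? : ∀ {m} (x : Vec X.U m) (b : Vec A.U m) → Dec (Consistent x b)
  consistent? x b = FinP.all? λ t → FinP.all? λ t' →
    (Vec.lookup x t X.≟U Vec.lookup x t') →-dec (Vec.lookup b t A.≟U Vec.lookup b t')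

  consistent-empty : ∀ {m} (x : Vec X.U m) (b : Vec A.U m) → m ≡ 0 → Consistent x b
  consistent-empty x b refl ()

  consistent-proj : ∀ {m m'} (x : Vec X.U m) b (is : Vec (Fin m) m') → Consistent x b → Consistent (proj is x) (proj is b)
  consistent-proj x b is c t t' e =
    trans (proj-lookup is b t) (trans (c _ _ (trans (sym (proj-lookup is x t)) (trans e (proj-lookup is x t'))))
                                      (sym (proj-lookup is b t')))

  valueAt : ∀ {m} → X.U → Vec X.U m → Vec A.U m → Maybe A.U
  valueAt y []       []       = nothing
  valueAt y (x ∷ x') (b ∷ b') = if ⌊ y X.≟U x ⌋ then just b else valueAt y x' b'

  valueAt-nothing : ∀ {m} y (x : Vec X.U m) b → occurs y x ≡ false → valueAt y x b ≡ nothing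
  valueAt-nothing y []       []       e = refl
  valueAt-nothing y (x ∷ x') (b ∷ b') e with y X.≟U x
  ... | no _ = valueAt-nothing y x' b' e

  valueAt-first : ∀ {m} y (x : Vec X.U m) b → occurs y x ≡ true →
                  ∃ λ t → Vec.lookup x t ≡ y × valueAt y x b ≡ just (Vec.lookup b t)
  valueAt-first y (x ∷ x') (b ∷ b') e with y X.≟U x
  ... | yes refl = zero , refl , refl
  ... | no _ with valueAt-first y x' b' e
  ...   | t , e₁ , e₂ = suc t , e₁ , e₂

  valueAt-consistent : ∀ {m} (x : Vec X.U m) b → Consistent x b → ∀ t → valueAt (Vec.lookup x t) x b ≡ just (Vec.lookup b t)
  valueAt-consistent x b c t with valueAt-first (Vec.lookup x t) x b (occurs⁺ _ x t refl)
  ... | t' , e₁ , e₂ = trans e₂ (cong just (c t' t e₁))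

  assignment : ∀ {m} → Vec X.U m → Vec A.U m → PMap
  assignment x b = Vec.tabulate (λ i → valueAt (elemAt i) x b)

  lookup-assignment : ∀ {m} (x : Vec X.U m) b i → Vec.lookup (assignment x b) i ≡ valueAt (elemAt i) x b
  lookup-assignment x b i = VecP.lookup∘tabulate _ i

  applyT-assignment : ∀ {m} (x : Vec X.U m) b → Consistent x b → applyT (assignment x b) x ≡ just b
  applyT-assignment x b c = applyT-just (assignment x b) x b λ t → begin
    eval (assignment x b) (Vec.lookup x t)              ≡⟨ eval-indexOf _ _ ⟩
    Vec.lookup (assignment x b) (indexOf (Vec.lookup x t)) ≡⟨ lookup-assignment x b _ ⟩
    valueAt (elemAt (indexOf (Vec.lookup x t))) x b     ≡⟨ cong (λ y → valueAt y x b) (elemAt-indexOf _) ⟩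
    valueAt (Vec.lookup x t) x b                        ≡⟨ valueAt-consistent x b c t ⟩
    just (Vec.lookup b t)                               ∎
    where open ≡-Reasoning

  assignment-domain : ∀ {m} (x : Vec X.U m) b → HasDomain (support x) (assignment x b)
  assignment-domain x b i rewrite lookup-support x i | lookup-assignment x b i with bool-cases (occurs (elemAt i) x)
  ... | inj₁ e rewrite e with valueAt-first (elemAt i) x b e
  ...   | _ , _ , e₂ rewrite e₂ = tt
  assignment-domain x b i | inj₂ e rewrite e | valueAt-nothing (elemAt i) x b e = tt

  domain⇒applyT : ∀ {m} (x : Vec X.U m) g → HasDomain (support x) g → ∃ λ b → applyT g x ≡ just b
  domain⇒applyT x g d = b , applyT-just g x b values
    where
      defined : ∀ {o} → DefinedIff true o → ∃ λ a → o ≡ just a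
      defined {just a} _ = a , refl
      value : ∀ t → ∃ λ a → Vec.lookup g (indexOf (Vec.lookup x t)) ≡ just a
      value t = defined (subst (λ s → DefinedIff s (Vec.lookup g (indexOf (Vec.lookup x t))))
                               (indexOf∈support x t) (d (indexOf (Vec.lookup x t))))
      b = Vec.tabulate (λ t → proj₁ (value t))
      values : ∀ t → eval g (Vec.lookup x t) ≡ just (Vec.lookup b t)
      values t = trans (eval-indexOf g _) (trans (proj₂ (value t)) (cong just (sym (VecP.lookup∘tabulate _ t))))

  funsOn⇒applyT : ∀ {m} (x : Vec X.U m) g → g ∈ funsOn (support x) → ∃ λ b → applyT g x ≡ just b
  funsOn⇒applyT x g g∈ = domain⇒applyT x g (funsOn-domain (support x) g∈)

  applyT⇒consistent : ∀ {m} g (x : Vec X.U m) b → applyT g x ≡ just b → Consistent x b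
  applyT⇒consistent g x b e t t' x≡ =
    just-injective (trans (sym (applyT-just⁻ g x b e t)) (trans (cong (eval g) x≡) (applyT-just⁻ g x b e t')))

  applyT⇒≡assignment : ∀ {m} (x : Vec X.U m) g b → HasDomain (support x) g → applyT g x ≡ just b → g ≡ assignment x b
  applyT⇒≡assignment x g b d e = lookup-ext pointwise
    where
      pointwise : ∀ i → Vec.lookup g i ≡ Vec.lookup (assignment x b) i
      pointwise i with bool-cases (occurs (elemAt i) x)
      ... | inj₁ occ with occurs⁻ (elemAt i) x occ
      ...   | t , e' = begin
        Vec.lookup g i                ≡⟨ cong (Vec.lookup g) (indexOf-elemAt i) ⟨
        Vec.lookup g (indexOf (elemAt i)) ≡⟨ eval-indexOf g (elemAt i) ⟨
        eval g (elemAt i)             ≡⟨ cong (eval g) e' ⟨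
        eval g (Vec.lookup x t)       ≡⟨ applyT-just⁻ g x b e t ⟩
        just (Vec.lookup b t)         ≡⟨ valueAt-consistent x b (applyT⇒consistent g x b e) t ⟨
        valueAt (Vec.lookup x t) x b  ≡⟨ cong (λ y → valueAt y x b) e' ⟩
        valueAt (elemAt i) x b        ≡⟨ lookup-assignment x b i ⟨
        Vec.lookup (assignment x b) i ∎
        where open ≡-Reasoning
      pointwise i | inj₂ occ = trans (undefined (subst (λ s → DefinedIff s (Vec.lookup g i)) (trans (lookup-support x i) occ) (d i)))
                                     (sym (trans (lookup-assignment x b i) (valueAt-nothing (elemAt i) x b occ)))
        where
          undefined : ∀ {o} → DefinedIff false o → o ≡ nothing
          undefined {nothing} _ = refl

  restrict-assignment : ∀ {m m'} (x : Vec X.U m) b (is : Vec (Fin m) m') → Consistent x b →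
                        restrict (support (proj is x)) (assignment x b) ≡ assignment (proj is x) (proj is b)
  restrict-assignment x b is c = lookup-ext pointwise
    where
      y = proj is x
      pointwise : ∀ i → Vec.lookup (restrict (support y) (assignment x b)) i ≡ Vec.lookup (assignment y (proj is b)) i
      pointwise i rewrite VecP.lookup-zipWith (λ b v → if b then v else nothing) i (support y) (assignment x b)
                        | lookup-support y i | lookup-assignment x b i | lookup-assignment y (proj is b) i
                   with bool-cases (occurs (elemAt i) y)
      ... | inj₁ occ rewrite occ with occurs⁻ (elemAt i) y occ
      ...   | t , e' = begin
        valueAt (elemAt i) x b                    ≡⟨ cong (λ z → valueAt z x b) (trans (sym e') (proj-lookup is x t)) ⟩
        valueAt (Vec.lookup x (Vec.lookup is t)) x b ≡⟨ valueAt-consistent x b c (Vec.lookup is t) ⟩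
        just (Vec.lookup b (Vec.lookup is t))     ≡⟨ cong just (proj-lookup is b t) ⟨
        just (Vec.lookup (proj is b) t)           ≡⟨ valueAt-consistent y (proj is b) (consistent-proj x b is c) t ⟨
        valueAt (Vec.lookup y t) y (proj is b)    ≡⟨ cong (λ z → valueAt z y (proj is b)) e' ⟩
        valueAt (elemAt i) y (proj is b)          ∎
        where open ≡-Reasoning
      pointwise i | inj₂ occ rewrite occ = sym (valueAt-nothing (elemAt i) y (proj is b) occ)

  enumerate : (l : List X.U) (S : Subset (length l)) → Vec X.U ∣ S ∣
  enumerate []      []          = []
  enumerate (y ∷ l) (true ∷ S)  = y ∷ enumerate l S
  enumerate (y ∷ l) (false ∷ S) = enumerate l S

  occurs-enumerate⇒∈ : (l : List X.U) (S : Subset (length l)) (y : X.U) → occurs y (enumerate l S) ≡ true → y ∈ l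
  occurs-enumerate⇒∈ []      []         y ()
  occurs-enumerate⇒∈ (z ∷ l) (true ∷ S) y e with y X.≟U z
  ... | yes refl = here refl
  ... | no _     = there (occurs-enumerate⇒∈ l S y e)
  occurs-enumerate⇒∈ (z ∷ l) (false ∷ S) y e = there (occurs-enumerate⇒∈ l S y e)

  occurs-enumerate : (l : List X.U) → Unique l → (S : Subset (length l)) →
                     ∀ i → occurs (List.lookup l i) (enumerate l S) ≡ Vec.lookup S i
  occurs-enumerate (z ∷ l) u (true ∷ S) zero with z X.≟U z
  ... | yes _   = refl
  ... | no z≢z  = ⊥-elim (z≢z refl)
  occurs-enumerate (z ∷ l) (z∉l AllPairs.∷ u) (false ∷ S) zero with bool-cases (occurs z (enumerate l S))
  ... | inj₁ e = ⊥-elim (All.lookup z∉l (occurs-enumerate⇒∈ l S z e) refl)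
  ... | inj₂ e = e
  occurs-enumerate (z ∷ l) (z∉l AllPairs.∷ u) (true ∷ S) (suc i) with List.lookup l i X.≟U z
  ... | yes e = ⊥-elim (All.lookup z∉l (∈-lookup {xs = l} i) (sym e))
  ... | no _  = occurs-enumerate l u S i
  occurs-enumerate (z ∷ l) (z∉l AllPairs.∷ u) (false ∷ S) (suc i) = occurs-enumerate l u S i

  -- a tuple listing the elements of S ⊆ X, used to index p_S by tuples
  members : (S : Subset n) → Vec X.U ∣ S ∣
  members = enumerate X.elems

  support-members : (S : Subset n) → support (members S) ≡ S
  support-members S = lookup-ext λ i → trans (lookup-support (members S) i) (occurs-enumerate X.elems X-unique S i)

  ⊆support⇒proj : ∀ {m m'} (x : Vec X.U m) (y : Vec X.U m') →
                  (∀ i → Vec.lookup (support y) i ≡ true → Vec.lookup (support x) i ≡ true) →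
                  ∃ λ (is : Vec (Fin m) m') → proj is x ≡ y
  ⊆support⇒proj x y h = is , lookup-ext entry
    where
      occurs-in-x : ∀ t → occurs (Vec.lookup y t) x ≡ true
      occurs-in-x t = begin
        occurs (Vec.lookup y t) x                      ≡⟨ cong (λ z → occurs z x) (elemAt-indexOf _) ⟨
        occurs (elemAt (indexOf (Vec.lookup y t))) x   ≡⟨ lookup-support x _ ⟨
        Vec.lookup (support x) (indexOf (Vec.lookup y t)) ≡⟨ h _ (indexOf∈support y t) ⟩
        true                                           ∎
        where open ≡-Reasoning
      is = Vec.tabulate (λ t → proj₁ (occurs⁻ _ x (occurs-in-x t)))
      entry : ∀ t → Vec.lookup (proj is x) t ≡ Vec.lookup y t
      entry t = trans (proj-lookup is x t)
                      (trans (cong (Vec.lookup x) (VecP.lookup∘tabulate _ t)) (proj₂ (occurs⁻ _ x (occurs-in-x t))))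

  -- Maps with domain {x} correspond to the tuples b consistent with x, via g ↦ g(x).
  ∑-funsOn : ∀ {m} (x : Vec X.U m) (F : PMap → ℚ) →
             ∑ (funsOn (support x)) F ≡ ∑ (allVecs A.elems m) (λ b → when (consistent? x b) (F (assignment x b)))
  ∑-funsOn {m} x F =
    trans (∑-fibres (funsOn (support x)) (allVecs A.elems m) (λ g b → applyT g x ≡ just b) (λ g b → applyT g x ≟M just b)
                    (allVecs-unique A.elems A-unique m) value F)
          (∑-cong (allVecs A.elems m) fibre)
    where
      value : ∀ {g} → g ∈ funsOn (support x) →
              Σ[ b ∈ Vec A.U m ] (b ∈ allVecs A.elems m × applyT g x ≡ just b ×
                                  (∀ {b'} → b' ∈ allVecs A.elems m → applyT g x ≡ just b' → b' ≡ b))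
      value {g} g∈ with funsOn⇒applyT x g g∈
      ... | b , e = b , ∈-allVecs A.elems A-complete b , e , λ _ e' → just-injective (trans (sym e') e)
      fibre : ∀ b → ∑ (funsOn (support x)) (λ g → when (applyT g x ≟M just b) (F g))
                      ≡ when (consistent? x b) (F (assignment x b))
      fibre b = by-cases (consistent? x b)
        where
          by-cases : (d : Dec (Consistent x b)) →
                     ∑ (funsOn (support x)) (λ g → when (applyT g x ≟M just b) (F g)) ≡ when d (F (assignment x b))
          by-cases (yes c) =
            trans (∑-single (funsOn (support x)) (funsOn-unique (support x))
                            (∈-funsOn (support x) (assignment x b) (assignment-domain x b)) others)
                  (when-yes (applyT (assignment x b) x ≟M just b) _ (applyT-assignment x b c))
            where
              others : ∀ {g} → g ∈ funsOn (support x) → g ≢ assignment x b → when (applyT g x ≟M just b) (F g) ≡ 0ℚ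
              others {g} g∈ g≢ = when-no (applyT g x ≟M just b) (F g)
                                         (g≢ ∘ applyT⇒≡assignment x g b (funsOn-domain (support x) g∈))
          by-cases (no ¬c) = ∑-zero (funsOn (support x)) λ {g} _ →
            when-no (applyT g x ≟M just b) (F g) (¬c ∘ applyT⇒consistent g x b)

  ∑-funsOn-restrict : ∀ {m m'} (x : Vec X.U m) (is : Vec (Fin m) m') (f : PMap) (c : Vec A.U m') →
                      HasDomain (support (proj is x)) f → applyT f (proj is x) ≡ just c → (F : PMap → ℚ) →
                      ∑ (funsOn (support x)) (λ g → when (restrict (support (proj is x)) g ≟P f) (F g))
                        ≡ ∑ (allVecs A.elems m) (λ b → when (proj is b ≟V c) (when (consistent? x b) (F (assignment x b))))
  ∑-funsOn-restrict {m} x is f c df fc F = trans (∑-funsOn x _) (∑-cong (allVecs A.elems m) restricted)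
    where
      y = proj is x
      restricted : ∀ b → when (consistent? x b) (when (restrict (support y) (assignment x b) ≟P f) (F (assignment x b)))
                         ≡ when (proj is b ≟V c) (when (consistent? x b) (F (assignment x b)))
      restricted b = by-cases (consistent? x b)
        where
          by-cases : (d : Dec (Consistent x b)) →
                     when d (when (restrict (support y) (assignment x b) ≟P f) (F (assignment x b)))
                       ≡ when (proj is b ≟V c) (when d (F (assignment x b)))
          by-cases (no _)   = sym (when-0 (proj is b ≟V c))
          by-cases (yes cb) = when-cong (restrict (support y) (assignment x b) ≟P f) (proj is b ≟V c) (F (assignment x b)) ⇒ ⇐
            where
              ⇒ : restrict (support y) (assignment x b) ≡ f → proj is b ≡ c
              ⇒ e = just-injective (begin
                just (proj is b)                                 ≡⟨ applyT-assignment y (proj is b) (consistent-proj x b is cb) ⟨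
                applyT (assignment y (proj is b)) y              ≡⟨ cong (λ g → applyT g y) (restrict-assignment x b is cb) ⟨
                applyT (restrict (support y) (assignment x b)) y ≡⟨ cong (λ g → applyT g y) e ⟩
                applyT f y                                       ≡⟨ fc ⟩
                just c                                           ∎)
                where open ≡-Reasoning
              ⇐ : proj is b ≡ c → restrict (support y) (assignment x b) ≡ f
              ⇐ e = trans (restrict-assignment x b is cb) (trans (cong (assignment y) e) (sym (applyT⇒≡assignment y f c df fc)))

  induced : ∀ {m} → Vec X.U m → (Vec A.U m → ℚ) → PMap → ℚ
  induced x φ g = maybe φ 0ℚ (applyT g x)

  VanishesOffConsistent : ∀ {m} → Vec X.U m → (Vec A.U m → ℚ) → Set
  VanishesOffConsistent x φ = ∀ b → ¬ Consistent x b → φ b ≡ 0ℚ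

  when-consistent-induced : ∀ {m} (x : Vec X.U m) (φ : Vec A.U m → ℚ) → VanishesOffConsistent x φ →
                            ∀ b → when (consistent? x b) (induced x φ (assignment x b)) ≡ φ b
  when-consistent-induced x φ φ-vanishes b = by-cases (consistent? x b)
    where
      by-cases : (d : Dec (Consistent x b)) → when d (induced x φ (assignment x b)) ≡ φ b
      by-cases (yes c) rewrite applyT-assignment x b c = refl
      by-cases (no ¬c) = sym (φ-vanishes b ¬c)

  ∑-induced : ∀ {m} (x : Vec X.U m) (φ : Vec A.U m → ℚ) → VanishesOffConsistent x φ →
              ∑ (funsOn (support x)) (induced x φ) ≡ ∑ (allVecs A.elems m) φ
  ∑-induced {m} x φ φ-vanishes =
    trans (∑-funsOn x _) (∑-cong (allVecs A.elems m) (when-consistent-induced x φ φ-vanishes))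

  induced-marginal : ∀ {m m'} (x : Vec X.U m) (is : Vec (Fin m) m') (φ : Vec A.U m → ℚ) → VanishesOffConsistent x φ →
                     (ψ : Vec A.U m' → ℚ) →
                     (∀ c → ψ c ≡ ∑ (allVecs A.elems m) (λ b → when (proj is b ≟V c) (φ b))) →
                     ∀ f → f ∈ funsOn (support (proj is x)) →
                     induced (proj is x) ψ f
                       ≡ ∑ (filter (λ g → restrict (support (proj is x)) g ≟P f) (funsOn (support x))) (induced x φ)
  induced-marginal {m} x is φ φ-vanishes ψ ψ-marginal f f∈ with funsOn⇒applyT (proj is x) f f∈
  ... | c , fc rewrite fc = begin
    ψ c
      ≡⟨ ψ-marginal c ⟩
    ∑ (allVecs A.elems m) (λ b → when (proj is b ≟V c) (φ b))
      ≡⟨ ∑-cong (allVecs A.elems m) (λ b → cong (when (proj is b ≟V c)) (when-consistent-induced x φ φ-vanishes b)) ⟨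
    ∑ (allVecs A.elems m) (λ b → when (proj is b ≟V c) (when (consistent? x b) (induced x φ (assignment x b))))
      ≡⟨ ∑-funsOn-restrict x is f c (funsOn-domain (support (proj is x)) f∈) fc (induced x φ) ⟨
    ∑ (funsOn (support x)) (λ g → when (restrict (support (proj is x)) g ≟P f) (induced x φ g))
      ≡⟨ ∑-filter (λ g → restrict (support (proj is x)) g ≟P f) (funsOn (support x)) _ ⟨
    ∑ (filter (λ g → restrict (support (proj is x)) g ≟P f) (funsOn (support x))) (induced x φ) ∎
    where open ≡-Reasoning

  record TupleSolution (k : ℕ) : Set where
    field
      μ : ∀ {m} → Vec X.U m → Vec A.U m → ℚ
      ν : ∀ R → Vec X.U (ar R) → Vec A.U (ar R) → ℚ
      μ-nonneg     : ∀ {m} → 1 ≤ m → m ≤ k → ∀ x b → 0ℚ ≤ℚ μ {m} x b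
      μ-normalised : ∀ {m} → 1 ≤ m → m ≤ k → ∀ x → ∑ (allVecs A.elems m) (μ x) ≡ 1ℚ
      μ-consistent : ∀ {m} → 1 ≤ m → m ≤ k → ∀ x → VanishesOffConsistent {m} x (μ x)
      μ-marginal   : ∀ {m m'} → 1 ≤ m' → m' ≤ k → m ≤ k → ∀ (x : Vec X.U m) (is : Vec (Fin m) m') (c : Vec A.U m') →
                     μ (proj is x) c ≡ ∑ (allVecs A.elems m) (λ b → when (proj is b ≟V c) (μ x b))
      ν-nonneg     : ∀ R x → T (X.rel R x) → ∀ a → 0ℚ ≤ℚ ν R x a
      ν-normalised : ∀ R x → T (X.rel R x) → ∑ (allVecs A.elems (ar R)) (ν R x) ≡ 1ℚ
      ν-respects   : ∀ R x → T (X.rel R x) → ∀ a → ¬ (T (A.rel R a) × Consistent x a) → ν R x a ≡ 0ℚ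
      ν-marginal   : ∀ R x → T (X.rel R x) → ∀ {m'} → 1 ≤ m' → m' ≤ k → (is : Vec (Fin (ar R)) m') (c : Vec A.U m') →
                     μ (proj is x) c ≡ ∑ (allVecs A.elems (ar R)) (λ a → when (proj is a ≟V c) (ν R x a))

  module SolutionFromTuples {k : ℕ} (ts : TupleSolution k) where
    open TupleSolution ts

    p : Subset n → PMap → ℚ
    p S = induced (members S) (μ (members S))

    pC : (R : Sym) → Vec X.U (ar R) → PMap → ℚ
    pC R x = induced x (ν R x)

    funsOn-members : ∀ S {f} → f ∈ funsOn S → f ∈ funsOn (support (members S))
    funsOn-members S {f} = subst (λ W → f ∈ funsOn W) (sym (support-members S))

    induced-range : ∀ {m} (x : Vec X.U m) (φ : Vec A.U m → ℚ) →
                    (∀ b → 0ℚ ≤ℚ φ b) → ∑ (allVecs A.elems m) φ ≡ 1ℚ →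
                    ∀ f → f ∈ funsOn (support x) → 0ℚ ≤ℚ induced x φ f × induced x φ f ≤ℚ 1ℚ
    induced-range x φ φ≥0 ∑φ≡1 f f∈ with funsOn⇒applyT x f f∈
    ... | c , e rewrite e =
      φ≥0 c , ℚP.≤-trans (term≤∑ (allVecs A.elems _) (λ {b} _ → φ≥0 b) (∈-allVecs A.elems A-complete c))
                         (ℚP.≤-reflexive ∑φ≡1)

    p-range : ∀ S → 1 ≤ ∣ S ∣ → ∣ S ∣ ≤ k → ∀ f → f ∈ funsOn S → 0ℚ ≤ℚ p S f × p S f ≤ℚ 1ℚ
    p-range S 1≤ ≤k f f∈ =
      induced-range (members S) _ (μ-nonneg 1≤ ≤k (members S)) (μ-normalised 1≤ ≤k (members S)) f (funsOn-members S f∈)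

    pC-range : ∀ R x → T (X.rel R x) → ∀ g → g ∈ funsOn (support x) → 0ℚ ≤ℚ pC R x g × pC R x g ≤ℚ 1ℚ
    pC-range R x t = induced-range x (ν R x) (ν-nonneg R x t) (ν-normalised R x t)

    normalised : ∀ S → 1 ≤ ∣ S ∣ → ∣ S ∣ ≤ k → ∑ (funsOn S) (p S) ≡ 1ℚ
    normalised S 1≤ ≤k = begin
      ∑ (funsOn S) (p S)                          ≡⟨ cong (λ W → ∑ (funsOn W) (p S)) (support-members S) ⟨
      ∑ (funsOn (support (members S))) (p S)      ≡⟨ ∑-induced (members S) (μ (members S)) (μ-consistent 1≤ ≤k (members S)) ⟩
      ∑ (allVecs A.elems ∣ S ∣) (μ (members S))   ≡⟨ μ-normalised 1≤ ≤k (members S) ⟩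
      1ℚ                                          ∎
      where open ≡-Reasoning

    members-proj : ∀ {U W} → U ⊆ W → ∃ λ is → proj is (members W) ≡ members U
    members-proj {U} {W} U⊆W = ⊆support⇒proj (members W) (members U) λ i e →
      subst (λ Z → Vec.lookup Z i ≡ true) (sym (support-members W))
            (⊆-elim U⊆W i (subst (λ Z → Vec.lookup Z i ≡ true) (support-members U) e))

    marginal : ∀ U W → 1 ≤ ∣ U ∣ → U ⊆ W → ∣ W ∣ ≤ k → ∀ f → f ∈ funsOn U →
               p U f ≡ ∑ (filter (λ g → restrict U g ≟P f) (funsOn W)) (p W)
    marginal U W 1≤ U⊆W ≤k f f∈ with members-proj U⊆W
    ... | is , proj≡ =
      trans (cong (λ z → induced z (μ z) f) (sym proj≡))
        (trans (induced-marginal x is (μ x) (μ-consistent 1≤∣W∣ ≤k x) (μ (proj is x)) (μ-marginal 1≤ ∣U∣≤k ≤k x is) f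
                                 (subst (λ Z → f ∈ funsOn Z) (sym support-proj) f∈))
               (cong₂ (λ U' W' → ∑ (filter (λ g → restrict U' g ≟P f) (funsOn W')) (p W)) support-proj (support-members W)))
      where
        x = members W
        support-proj : support (proj is x) ≡ U
        support-proj = trans (cong support proj≡) (support-members U)
        ∣U∣≤∣W∣ = SubsetP.p⊆q⇒∣p∣≤∣q∣ U⊆W
        ∣U∣≤k = ℕP.≤-trans ∣U∣≤∣W∣ ≤k
        1≤∣W∣ = ℕP.≤-trans 1≤ ∣U∣≤∣W∣

    marginalC : ∀ R x → T (X.rel R x) → ∀ U → 1 ≤ ∣ U ∣ → U ⊆ support x → ∣ U ∣ ≤ k →
                ∀ f → f ∈ funsOn U →
                p U f ≡ ∑ (filter (λ g → restrict U g ≟P f) (funsOn (support x))) (pC R x)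
    marginalC R x t U 1≤ U⊆ ≤k f f∈
      with ⊆support⇒proj x (members U) (λ i e → ⊆-elim U⊆ i (subst (λ Z → Vec.lookup Z i ≡ true) (support-members U) e))
    ... | is , proj≡ =
      trans (cong (λ z → induced z (μ z) f) (sym proj≡))
        (trans (induced-marginal x is (ν R x) (λ b ¬c → ν-respects R x t b (¬c ∘ proj₂))
                                 (μ (proj is x)) (ν-marginal R x t 1≤ ≤k is) f
                                 (subst (λ Z → f ∈ funsOn Z) (sym support-proj) f∈))
               (cong (λ U' → ∑ (filter (λ g → restrict U' g ≟P f) (funsOn (support x))) (pC R x)) support-proj))
      where
        support-proj : support (proj is x) ≡ U
        support-proj = trans (cong support proj≡) (support-members U)

    respects : ∀ R x → T (X.rel R x) → ∀ g → g ∈ funsOn (support x) → sat R g x ≡ false → pC R x g ≡ 0ℚ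
    respects R x t g g∈ unsat with funsOn⇒applyT x g g∈
    ... | c , e = trans (cong (maybe (ν R x) 0ℚ) e)
                        (ν-respects R x t c (λ (r , _) → subst T (trans (sym (cong (maybe (A.rel R) false) e)) unsat) r))

    solution : SA-feasible k X A
    solution = record
      { p = p ; pC = pC ; p-range = p-range ; pC-range = pC-range ; normalised = normalised
      ; marginal = marginal ; marginalC = marginalC ; respects = respects }

  normalised-from-marginal : ∀ {m} (φ : Vec A.U m → ℚ) (ψ : Vec A.U 1 → ℚ) (i : Fin m) →
                             (∀ c → ψ c ≡ ∑ (allVecs A.elems m) (λ a → when (proj (i ∷ []) a ≟V c) (φ a))) →
                             ∑ (allVecs A.elems 1) ψ ≡ 1ℚ → ∑ (allVecs A.elems m) φ ≡ 1ℚ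
  normalised-from-marginal {m} φ ψ i ψ-marginal ∑ψ≡1 =
    trans (∑-fibres (allVecs A.elems m) (allVecs A.elems 1) (λ a c → proj (i ∷ []) a ≡ c) (λ a c → proj (i ∷ []) a ≟V c)
                    (allVecs-unique A.elems A-unique 1)
                    (λ {a} _ → proj (i ∷ []) a , ∈-allVecs A.elems A-complete _ , refl , λ _ e → sym e) φ)
          (trans (sym (∑-cong (allVecs A.elems 1) ψ-marginal)) ∑ψ≡1)

  module TuplesFromSolution {k : ℕ} (1≤k : 1 ≤ k) (nullary-nonempty : ∀ R → ar R ≡ 0 → ∃ λ a → T (A.rel R a))
                            (sol : SA-feasible k X A) where
    open SAdefs.SASolution sol

    μ : ∀ {m} → Vec X.U m → Vec A.U m → ℚ
    μ x b = when (consistent? x b) (p (support x) (assignment x b))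

    νSA : ∀ R → Vec X.U (ar R) → Vec A.U (ar R) → ℚ
    νSA R x a = when (consistent? x a) (when (T? (A.rel R a)) (pC R x (assignment x a)))

    -- SA^k says nothing about p_{R()} for nullary R (there is no nonempty U ⊆ ∅),
    -- so the nullary constraints get the indicator of R^A, a distribution as R^A ⊆ A^0 is nonempty.
    ifEmpty : ∀ {B : Set} {m} → Vec B m → ℚ → ℚ → ℚ
    ifEmpty []      q₀ q = q₀
    ifEmpty (_ ∷ _) q₀ q = q

    ifEmpty-elim : ∀ {B : Set} {m} (x : Vec B m) q₀ q (P : ℚ → Set) → (m ≡ 0 → P q₀) → (Fin m → P q) →
                   P (ifEmpty x q₀ q)
    ifEmpty-elim []      q₀ q P h₀ h = h₀ refl
    ifEmpty-elim (_ ∷ _) q₀ q P h₀ h = h zero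

    ν : ∀ R → Vec X.U (ar R) → Vec A.U (ar R) → ℚ
    ν R x a = ifEmpty x (if A.rel R a then 1ℚ else 0ℚ) (νSA R x a)

    ifEmpty-nonempty : ∀ {B : Set} {m} (x : Vec B m) q₀ q → Fin m → ifEmpty x q₀ q ≡ q
    ifEmpty-nonempty (_ ∷ _) q₀ q _ = refl

    ν≡νSA : ∀ R x a → Fin (ar R) → ν R x a ≡ νSA R x a
    ν≡νSA R x a = ifEmpty-nonempty x _ _

    assignment∈funsOn : ∀ {m} (x : Vec X.U m) b → assignment x b ∈ funsOn (support x)
    assignment∈funsOn x b = ∈-funsOn (support x) (assignment x b) (assignment-domain x b)

    μ-nonneg : ∀ {m} → 1 ≤ m → m ≤ k → ∀ x b → 0ℚ ≤ℚ μ {m} x b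
    μ-nonneg {suc m} (s≤s z≤n) ≤k x b = when-nonneg (consistent? x b)
      (proj₁ (p-range (support x) (1≤∣support∣ x) (ℕP.≤-trans (∣support∣≤ x) ≤k)
                      (assignment x b) (assignment∈funsOn x b)))

    μ-normalised : ∀ {m} → 1 ≤ m → m ≤ k → ∀ x → ∑ (allVecs A.elems m) (μ x) ≡ 1ℚ
    μ-normalised {suc m} (s≤s z≤n) ≤k x =
      trans (sym (∑-funsOn x (p (support x)))) (normalised (support x) (1≤∣support∣ x) (ℕP.≤-trans (∣support∣≤ x) ≤k))

    μ-consistent : ∀ {m} → 1 ≤ m → m ≤ k → ∀ x → VanishesOffConsistent {m} x (μ x)
    μ-consistent _ _ x b = when-no (consistent? x b) _

    inconsistent-fibre : ∀ {m m'} (x : Vec X.U m) (is : Vec (Fin m) m') c → ¬ Consistent (proj is x) c →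
                         (φ : Vec A.U m → ℚ) → VanishesOffConsistent x φ → ∀ b → when (proj is b ≟V c) (φ b) ≡ 0ℚ
    inconsistent-fibre x is c ¬c φ φ-vanishes b with proj is b ≟V c
    ... | no _     = refl
    ... | yes refl = φ-vanishes b (¬c ∘ consistent-proj x b is)

    μ-marginal : ∀ {m m'} → 1 ≤ m' → m' ≤ k → m ≤ k → ∀ (x : Vec X.U m) (is : Vec (Fin m) m') (c : Vec A.U m') →
                 μ (proj is x) c ≡ ∑ (allVecs A.elems m) (λ b → when (proj is b ≟V c) (μ x b))
    μ-marginal {m} {suc m'} (s≤s z≤n) _ ≤k x is c = by-cases (consistent? y c)
      where
        y = proj is x
        by-cases : (d : Dec (Consistent y c)) →
                   when d (p (support y) (assignment y c)) ≡ ∑ (allVecs A.elems m) (λ b → when (proj is b ≟V c) (μ x b))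
        by-cases (yes cy) = begin
          p (support y) (assignment y c)
            ≡⟨ marginal (support y) (support x) (1≤∣support∣ y) (⊆-intro (support-proj⊆ x is))
                        (ℕP.≤-trans (∣support∣≤ x) ≤k) (assignment y c) (assignment∈funsOn y c) ⟩
          ∑ (filter (λ g → restrict (support y) g ≟P assignment y c) (funsOn (support x))) (p (support x))
            ≡⟨ ∑-filter (λ g → restrict (support y) g ≟P assignment y c) (funsOn (support x)) (p (support x)) ⟩
          ∑ (funsOn (support x)) (λ g → when (restrict (support y) g ≟P assignment y c) (p (support x) g))
            ≡⟨ ∑-funsOn-restrict x is (assignment y c) c (assignment-domain y c) (applyT-assignment y c cy) (p (support x)) ⟩
          ∑ (allVecs A.elems m) (λ b → when (proj is b ≟V c) (μ x b)) ∎
          where open ≡-Reasoning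
        by-cases (no ¬cy) = sym (∑-zero (allVecs A.elems m) (λ {b} _ →
          inconsistent-fibre x is c ¬cy (μ x) (λ b' ¬c' → when-no (consistent? x b') _ ¬c') b))

    νSA-respects : ∀ R x → T (X.rel R x) → ∀ a → when (consistent? x a) (pC R x (assignment x a)) ≡ νSA R x a
    νSA-respects R x t a = by-cases (consistent? x a) (T? (A.rel R a))
      where
        by-cases : (d : Dec (Consistent x a)) (r : Dec (T (A.rel R a))) →
                   when d (pC R x (assignment x a)) ≡ when d (when r (pC R x (assignment x a)))
        by-cases (no _)   r       = refl
        by-cases (yes ca) (yes _) = refl
        by-cases (yes ca) (no ¬r) = respects R x t (assignment x a) (assignment∈funsOn x a)
          (trans (cong (maybe (A.rel R) false) (applyT-assignment x a ca)) (¬-not ¬r))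
          where
            ¬-not : ∀ {b} → ¬ T b → b ≡ false
            ¬-not {true}  ¬t = ⊥-elim (¬t tt)
            ¬-not {false} _  = refl

    ν-marginal : ∀ R x → T (X.rel R x) → ∀ {m'} → 1 ≤ m' → m' ≤ k → (is : Vec (Fin (ar R)) m') (c : Vec A.U m') →
                 μ (proj is x) c ≡ ∑ (allVecs A.elems (ar R)) (λ a → when (proj is a ≟V c) (ν R x a))
    ν-marginal R x t {suc m'} (s≤s z≤n) ≤k (i ∷ is') c = by-cases (consistent? y c)
      where
        is = i ∷ is'
        y = proj is x
        by-cases : (d : Dec (Consistent y c)) →
                   when d (p (support y) (assignment y c)) ≡ ∑ (allVecs A.elems (ar R)) (λ a → when (proj is a ≟V c) (ν R x a))
        by-cases (yes cy) = begin
          p (support y) (assignment y c)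
            ≡⟨ marginalC R x t (support y) (1≤∣support∣ y) (⊆-intro (support-proj⊆ x is))
                         (ℕP.≤-trans (∣support∣≤ y) ≤k) (assignment y c) (assignment∈funsOn y c) ⟩
          ∑ (filter (λ g → restrict (support y) g ≟P assignment y c) (funsOn (support x))) (pC R x)
            ≡⟨ ∑-filter (λ g → restrict (support y) g ≟P assignment y c) (funsOn (support x)) (pC R x) ⟩
          ∑ (funsOn (support x)) (λ g → when (restrict (support y) g ≟P assignment y c) (pC R x g))
            ≡⟨ ∑-funsOn-restrict x is (assignment y c) c (assignment-domain y c) (applyT-assignment y c cy) (pC R x) ⟩
          ∑ (allVecs A.elems (ar R)) (λ a → when (proj is a ≟V c) (when (consistent? x a) (pC R x (assignment x a))))
            ≡⟨ ∑-cong (allVecs A.elems (ar R)) (λ a → cong (when (proj is a ≟V c))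
                                                           (trans (νSA-respects R x t a) (sym (ν≡νSA R x a i)))) ⟩
          ∑ (allVecs A.elems (ar R)) (λ a → when (proj is a ≟V c) (ν R x a)) ∎
          where open ≡-Reasoning
        by-cases (no ¬cy) = sym (∑-zero (allVecs A.elems (ar R)) (λ {a} _ → inconsistent-fibre x is c ¬cy (ν R x)
          (λ a' ¬c' → trans (ν≡νSA R x a' i) (when-no (consistent? x a') _ ¬c')) a))

    ν-nonneg : ∀ R x → T (X.rel R x) → ∀ a → 0ℚ ≤ℚ ν R x a
    ν-nonneg R x t a = ifEmpty-elim x _ _ (0ℚ ≤ℚ_) (λ _ → indicator-nonneg (A.rel R a))
      (λ _ → when-nonneg (consistent? x a) (by-cases (T? (A.rel R a))))
      where
        indicator-nonneg : ∀ b → 0ℚ ≤ℚ (if b then 1ℚ else 0ℚ)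
        indicator-nonneg true  = ℚP.nonNegative⁻¹ 1ℚ
        indicator-nonneg false = ℚP.≤-refl
        by-cases : (r : Dec (T (A.rel R a))) → 0ℚ ≤ℚ when r (pC R x (assignment x a))
        by-cases (yes _) = proj₁ (pC-range R x t (assignment x a) (assignment∈funsOn x a))
        by-cases (no _)  = ℚP.≤-refl

    ν-respects : ∀ R x → T (X.rel R x) → ∀ a → ¬ (T (A.rel R a) × Consistent x a) → ν R x a ≡ 0ℚ
    ν-respects R x t a ¬ra = ifEmpty-elim x _ _ (_≡ 0ℚ) nullary (λ _ → by-cases (consistent? x a) (T? (A.rel R a)))
      where
        nullary : ar R ≡ 0 → (if A.rel R a then 1ℚ else 0ℚ) ≡ 0ℚ
        nullary ar≡0 with A.rel R a
        ... | true  = ⊥-elim (¬ra (tt , consistent-empty x a ar≡0))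
        ... | false = refl
        by-cases : (d : Dec (Consistent x a)) (r : Dec (T (A.rel R a))) → when d (when r (pC R x (assignment x a))) ≡ 0ℚ
        by-cases (yes c) (yes r) = ⊥-elim (¬ra (r , c))
        by-cases (yes _) (no _)  = refl
        by-cases (no _)  _       = refl

    ν-normalised : ∀ R x → T (X.rel R x) → ∑ (allVecs A.elems (ar R)) (ν R x) ≡ 1ℚ
    ν-normalised R x t = by-arity (empty-or-index x)
      where
        empty-or-index : ∀ {B : Set} {m} → Vec B m → m ≡ 0 ⊎ Fin m
        empty-or-index []      = inj₁ refl
        empty-or-index (_ ∷ _) = inj₂ zero
        indicator-sum : ∀ {m} → m ≡ 0 → (x : Vec X.U m) (r : Vec A.U m → Bool) (q : Vec A.U m → ℚ) →
                        (∃ λ a → T (r a)) →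
                        ∑ (allVecs A.elems m) (λ a → ifEmpty x (if r a then 1ℚ else 0ℚ) (q a)) ≡ 1ℚ
        indicator-sum refl [] r q ([] , ra) with r []
        ... | true = refl
        by-arity : ar R ≡ 0 ⊎ Fin (ar R) → ∑ (allVecs A.elems (ar R)) (ν R x) ≡ 1ℚ
        by-arity (inj₁ ar≡0) = indicator-sum ar≡0 x (A.rel R) (νSA R x) (nullary-nonempty R ar≡0)
        by-arity (inj₂ i)    = normalised-from-marginal (ν R x) (μ (proj (i ∷ []) x)) i
          (ν-marginal R x t (s≤s z≤n) 1≤k (i ∷ [])) (μ-normalised (s≤s z≤n) 1≤k (proj (i ∷ []) x))

    tupleSolution : TupleSolution k
    tupleSolution = record
      { μ = μ ; ν = ν ; μ-nonneg = μ-nonneg ; μ-normalised = μ-normalised ; μ-consistent = μ-consistent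
      ; μ-marginal = μ-marginal ; ν-nonneg = ν-nonneg ; ν-normalised = ν-normalised ; ν-respects = ν-respects
      ; ν-marginal = ν-marginal }

-- The structure A^{*k}

module StarUniverse {σ : Signature} (Fσ : FinSignature σ) (k : ℕ) (B : Structure σ)
  (B-complete : ∀ a → a ∈ Structure.elems B) (B-unique : Unique (Structure.elems B)) where

  open Signature σ
  open FinSignature Fσ
  open StarDefs Fσ k
  module B = Structure B

  elems* : List (Star B)
  elems* = starElems B

  tupBlock : Fin k → List (Star B)
  tupBlock j = map (tup j) (allVecs B.elems (len j))

  conBlock : Sym → List (Star B)
  conBlock R = conList B R (allVecs B.elems (ar R))

  tup-injective : ∀ {j j' a a'} → _≡_ {A = Star B} (tup j a) (tup j' a') → Σ (j ≡ j') λ { refl → a ≡ a' }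
  tup-injective refl = refl , refl

  tup-injectiveʳ : ∀ {j a a'} → _≡_ {A = Star B} (tup j a) (tup j a') → a ≡ a'
  tup-injectiveʳ refl = refl

  con-injectiveʳ : ∀ {R a a' t t'} → _≡_ {A = Star B} (con R a t) (con R a' t') → a ≡ a'
  con-injectiveʳ refl = refl

  con-injective : ∀ {R R' a a' t t'} → _≡_ {A = Star B} (con R a t) (con R' a' t') → Σ (R ≡ R') λ { refl → a ≡ a' }
  con-injective refl = refl , refl

  ∈-conList : ∀ R (l : List (Vec B.U (ar R))) a t → a ∈ l → con R a t ∈ conList B R l
  ∈-conList R (a' ∷ l) a t a∈ with T? (B.rel R a')
  ∈-conList R (a' ∷ l) a t (here refl) | yes t' = here (cong (con R a) (T-irr t t'))
  ∈-conList R (a' ∷ l) a t (there a∈) | yes _  = there (∈-conList R l a t a∈)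
  ∈-conList R (a' ∷ l) a t (here refl) | no ¬t = ⊥-elim (¬t t)
  ∈-conList R (a' ∷ l) a t (there a∈) | no _   = ∈-conList R l a t a∈

  ∈-conList⁻ : ∀ R (l : List (Vec B.U (ar R))) c → c ∈ conList B R l → ∃ λ a → ∃ λ t → c ≡ con R a t × a ∈ l
  ∈-conList⁻ R (a' ∷ l) c c∈ with T? (B.rel R a')
  ∈-conList⁻ R (a' ∷ l) c (here refl) | yes t' = a' , t' , refl , here refl
  ∈-conList⁻ R (a' ∷ l) c (there c∈) | yes _ with ∈-conList⁻ R l c c∈
  ... | a , t , e , a∈ = a , t , e , there a∈
  ∈-conList⁻ R (a' ∷ l) c c∈ | no _ with ∈-conList⁻ R l c c∈
  ... | a , t , e , a∈ = a , t , e , there a∈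

  conList-unique : ∀ R (l : List (Vec B.U (ar R))) → Unique l → Unique (conList B R l)
  conList-unique R []       u = AllPairs.[]
  conList-unique R (a' ∷ l) (a'∉l AllPairs.∷ u) with T? (B.rel R a')
  ... | yes t' = All.tabulate (λ {c} c∈ e → fresh c c∈ e) AllPairs.∷ conList-unique R l u
    where
      fresh : ∀ c → c ∈ conList B R l → con R a' t' ≢ c
      fresh c c∈ refl with ∈-conList⁻ R l c c∈
      ... | a , t , e , a∈ with con-injective e
      ...   | refl , refl = All.lookup a'∉l a∈ refl
  ... | no _ = conList-unique R l u

  ∈-elems* : ∀ c → c ∈ elems*
  ∈-elems* (tup j a) = ∈-++⁺ˡ (∈-concatMap⁺ tupBlock {xs = allFin k}
    (Any.map (λ { refl → ∈-map⁺ (tup j) (∈-allVecs B.elems B-complete a) }) (∈-allFin j)))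
  ∈-elems* (con R a t) = ∈-++⁺ʳ (concatMap tupBlock (allFin k)) (∈-concatMap⁺ conBlock {xs = syms}
    (Any.map (λ { refl → ∈-conList R (allVecs B.elems (ar R)) a t (∈-allVecs B.elems B-complete a) }) (syms-complete R)))

  tup∈tupBlocks : ∀ {c} → c ∈ concatMap tupBlock (allFin k) → ∃ λ j → ∃ λ a → c ≡ tup j a
  tup∈tupBlocks c∈ with find (∈-concatMap⁻ tupBlock {xs = allFin k} c∈)
  ... | j , _ , c∈j with ∈-map⁻ (tup j) c∈j
  ...   | a , _ , e = j , a , e

  con∈conBlocks : ∀ {c} → c ∈ concatMap conBlock syms → ∃ λ R → ∃ λ a → ∃ λ t → c ≡ con R a t
  con∈conBlocks {c} c∈ with find (∈-concatMap⁻ conBlock {xs = syms} c∈)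
  ... | R , _ , c∈R with ∈-conList⁻ R (allVecs B.elems (ar R)) c c∈R
  ...   | a , t , e , _ = R , a , t , e

  elems*-unique : Unique elems*
  elems*-unique =
    UniqueP.++⁺ (concatMap-unique tupBlock (allFin k) (UniqueP.allFin⁺ k)
                   (λ j → UniqueP.map⁺ tup-injectiveʳ (allVecs-unique B.elems B-unique _)) same-length)
                (concatMap-unique conBlock syms syms-unique
                   (λ R → conList-unique R (allVecs B.elems (ar R)) (allVecs-unique B.elems B-unique (ar R))) same-symbol)
                disjoint
    where
      same-length : ∀ {j j' c} → c ∈ tupBlock j → c ∈ tupBlock j' → j ≡ j'
      same-length c∈ c∈' with ∈-map⁻ _ c∈ | ∈-map⁻ _ c∈'
      ... | _ , _ , refl | _ , _ , e = proj₁ (tup-injective e)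
      same-symbol : ∀ {R R' c} → c ∈ conBlock R → c ∈ conBlock R' → R ≡ R'
      same-symbol {R} {R'} {c} c∈ c∈'
        with ∈-conList⁻ R (allVecs B.elems (ar R)) c c∈ | ∈-conList⁻ R' (allVecs B.elems (ar R')) c c∈'
      ... | _ , _ , refl , _ | _ , _ , e , _ = proj₁ (con-injective e)
      disjoint : ∀ {c} → ¬ (c ∈ concatMap tupBlock (allFin k) × c ∈ concatMap conBlock syms)
      disjoint (c∈ , c∈') with tup∈tupBlocks c∈ | con∈conBlocks c∈'
      ... | _ , _ , refl | _ , _ , _ , ()

  ∑-elems*-tup : (F : Star B → ℚ) (j : Fin k) → (∀ c → (∀ b → c ≢ tup j b) → F c ≡ 0ℚ) →
                 ∑ elems* F ≡ ∑ (allVecs B.elems (len j)) (λ b → F (tup j b))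
  ∑-elems*-tup F j F-vanishes = begin
    ∑ elems* F
      ≡⟨ ∑-++ (concatMap tupBlock (allFin k)) _ F ⟩
    ∑ (concatMap tupBlock (allFin k)) F + ∑ (concatMap conBlock syms) F
      ≡⟨ cong₂ _+_ (trans (∑-concatMap tupBlock (allFin k) F)
                          (∑-single (allFin k) (UniqueP.allFin⁺ k) (∈-allFin j) other-lengths))
                   (∑-zero (concatMap conBlock syms) constraints) ⟩
    ∑ (tupBlock j) F + 0ℚ
      ≡⟨ ℚP.+-identityʳ _ ⟩
    ∑ (tupBlock j) F
      ≡⟨ ∑-map (tup j) (allVecs B.elems (len j)) F ⟩
    ∑ (allVecs B.elems (len j)) (λ b → F (tup j b)) ∎
    where
      open ≡-Reasoning
      other-lengths : ∀ {j'} → j' ∈ allFin k → j' ≢ j → ∑ (tupBlock j') F ≡ 0ℚ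
      other-lengths {j'} _ j'≢j = ∑-zero (tupBlock j') λ c∈ → F-vanishes _ λ b e →
        j'≢j (proj₁ (tup-injective (trans (sym (proj₂ (proj₂ (∈-map⁻ (tup j') c∈)))) e)))
      constraints : ∀ {c} → c ∈ concatMap conBlock syms → F c ≡ 0ℚ
      constraints c∈ with con∈conBlocks c∈
      ... | _ , _ , _ , refl = F-vanishes _ (λ b ())

  ∑-elems*-con : (F : Star B → ℚ) (R : Sym) (g : Vec B.U (ar R) → ℚ) → (∀ a t → F (con R a t) ≡ g a) →
                 (∀ a → ¬ T (B.rel R a) → g a ≡ 0ℚ) → (∀ c → (∀ a t → c ≢ con R a t) → F c ≡ 0ℚ) →
                 ∑ elems* F ≡ ∑ (allVecs B.elems (ar R)) g
  ∑-elems*-con F R g F≡g g-vanishes F-vanishes = begin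
    ∑ elems* F
      ≡⟨ ∑-++ (concatMap tupBlock (allFin k)) _ F ⟩
    ∑ (concatMap tupBlock (allFin k)) F + ∑ (concatMap conBlock syms) F
      ≡⟨ cong₂ _+_ (∑-zero (concatMap tupBlock (allFin k)) tuples)
                   (trans (∑-concatMap conBlock syms F) (∑-single syms syms-unique (syms-complete R) other-symbols)) ⟩
    0ℚ + ∑ (conBlock R) F
      ≡⟨ ℚP.+-identityˡ _ ⟩
    ∑ (conBlock R) F
      ≡⟨ ∑-conList (allVecs B.elems (ar R)) ⟩
    ∑ (allVecs B.elems (ar R)) g ∎
    where
      open ≡-Reasoning
      other-symbols : ∀ {R'} → R' ∈ syms → R' ≢ R → ∑ (conBlock R') F ≡ 0ℚ
      other-symbols {R'} _ R'≢R = ∑-zero (conBlock R') λ {c} c∈ → F-vanishes c λ a t e →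
        R'≢R (proj₁ (con-injective (trans (sym (proj₁ (proj₂ (proj₂ (∈-conList⁻ R' (allVecs B.elems (ar R')) c c∈))))) e)))
      tuples : ∀ {c} → c ∈ concatMap tupBlock (allFin k) → F c ≡ 0ℚ
      tuples c∈ with tup∈tupBlocks c∈
      ... | _ , _ , refl = F-vanishes _ (λ a t ())
      ∑-conList : ∀ l → ∑ (conList B R l) F ≡ ∑ l g
      ∑-conList []      = refl
      ∑-conList (a ∷ l) with T? (B.rel R a)
      ... | yes t = cong₂ _+_ (F≡g a t) (∑-conList l)
      ... | no ¬t = sym (trans (cong (_+ ∑ l g) (g-vanishes a ¬t)) (trans (ℚP.+-identityˡ _) (sym (∑-conList l))))

≟-refl : {B : Set} (_≟_ : DecidableEquality B) (x : B) → (x ≟ x) ≡ yes refl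
≟-refl _≟_ x with x ≟ x
... | yes refl = refl
... | no x≢x   = ⊥-elim (x≢x refl)

module StarRelations {σ : Signature} (Fσ : FinSignature σ) (k : ℕ) (B : Structure σ) where

  open Signature σ
  open FinSignature Fσ
  open StarDefs Fσ k
  module B = Structure B

  TS-holds : ∀ j S a → starRel B (TS j S) (tup j a ∷ []) ≡ allEqOn B._≟U_ S a
  TS-holds j S a rewrite ≟-refl FinP._≟_ j = refl

  TS-holds⁻ : ∀ j S c → T (starRel B (TS j S) (c ∷ [])) → ∃ λ a → c ≡ tup j a × T (allEqOn B._≟U_ S a)
  TS-holds⁻ j S (tup j₁ a) t with j FinP.≟ j₁
  ... | yes refl = a , refl , t

  RS-holds : ∀ R S a t → starRel B (RS R S) (con R a t ∷ []) ≡ allEqOn B._≟U_ S a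
  RS-holds R S a t rewrite ≟-refl _≟S_ R = refl

  RS-holds⁻ : ∀ R S c → T (starRel B (RS R S) (c ∷ [])) → ∃ λ a → ∃ λ t → c ≡ con R a t × T (allEqOn B._≟U_ S a)
  RS-holds⁻ R S (con R₁ a t₁) t with R ≟S R₁
  ... | yes refl = a , t₁ , refl , t

  Ti-holds : ∀ j j' is a → T (starRel B (Ti j j' is) (tup j a ∷ tup j' (proj is a) ∷ []))
  Ti-holds j j' is a rewrite ≟-refl FinP._≟_ j | ≟-refl FinP._≟_ j' | ≟-refl (VecP.≡-dec B._≟U_) (proj is a) = tt

  Ti-holds⁻ : ∀ j j' is c d → T (starRel B (Ti j j' is) (c ∷ d ∷ [])) → ∃ λ a → c ≡ tup j a × d ≡ tup j' (proj is a)
  Ti-holds⁻ j j' is (tup j₁ a) (tup j₂ b) t with j FinP.≟ j₁ | j' FinP.≟ j₂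
  ... | yes refl | yes refl = a , refl , cong (tup j') (toWitness t)
  Ti-holds⁻ j j' is (tup j₁ a) (con _ _ _) ()
  Ti-holds⁻ j j' is (con _ _ _) d ()

  Ri-holds : ∀ R j is a t → T (starRel B (Ri R j is) (con R a t ∷ tup j (proj is a) ∷ []))
  Ri-holds R j is a t rewrite ≟-refl _≟S_ R | ≟-refl FinP._≟_ j | ≟-refl (VecP.≡-dec B._≟U_) (proj is a) = tt

  Ri-holds⁻ : ∀ R j is c d → T (starRel B (Ri R j is) (c ∷ d ∷ [])) →
              ∃ λ a → ∃ λ t → c ≡ con R a t × d ≡ tup j (proj is a)
  Ri-holds⁻ R j is (con R₁ a t₁) (tup j₂ b) t with R ≟S R₁ | j FinP.≟ j₂
  ... | yes refl | yes refl = a , t₁ , refl , cong (tup j) (toWitness t)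
  Ri-holds⁻ R j is (con R₁ a t₁) (con _ _ _) ()
  Ri-holds⁻ R j is (tup _ _) d ()

inconsistency-witness : {B C : Set} (_≟B_ : DecidableEquality B) (_≟C_ : DecidableEquality C) {m : ℕ} (x : Vec B m) (b : Vec C m) →
                        ¬ (∀ t t' → Vec.lookup x t ≡ Vec.lookup x t' → Vec.lookup b t ≡ Vec.lookup b t') →
                        ∃ λ t → ∃ λ t' → Vec.lookup x t ≡ Vec.lookup x t' × Vec.lookup b t ≢ Vec.lookup b t'
inconsistency-witness _≟B_ _≟C_ {m} x b ¬c
  with FinP.¬∀⟶∃¬ m _ (λ t → FinP.all? (λ t' → implication t t')) ¬c
  where implication = λ t t' → (Vec.lookup x t ≟B Vec.lookup x t') →-dec (Vec.lookup b t ≟C Vec.lookup b t')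
... | t , ¬∀t' with FinP.¬∀⟶∃¬ m _ (λ t' → (Vec.lookup x t ≟B Vec.lookup x t') →-dec (Vec.lookup b t ≟C Vec.lookup b t')) ¬∀t'
...   | t' , ¬imp with Vec.lookup x t ≟B Vec.lookup x t'
...     | yes e  = t , t' , e , (λ b≡ → ¬imp (λ _ → b≡))
...     | no x≢  = ⊥-elim (¬imp (λ e → ⊥-elim (x≢ e)))

pair : ∀ {m} → Fin m → Fin m → Subset m
pair t t' = Vec.tabulate (λ i → ⌊ i FinP.≟ t ⌋ ∨ ⌊ i FinP.≟ t' ⌋)

lookup-pair : ∀ {m} (t t' i : Fin m) → Vec.lookup (pair t t') i ≡ true → i ≡ t ⊎ i ≡ t'
lookup-pair t t' i e rewrite VecP.lookup∘tabulate (λ i → ⌊ i FinP.≟ t ⌋ ∨ ⌊ i FinP.≟ t' ⌋) i with i FinP.≟ t | i FinP.≟ t'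
... | yes i≡t | _       = inj₁ i≡t
... | no _    | yes i≡t' = inj₂ i≡t'

lookup-pairˡ : ∀ {m} (t t' : Fin m) → Vec.lookup (pair t t') t ≡ true
lookup-pairˡ t t' rewrite VecP.lookup∘tabulate (λ i → ⌊ i FinP.≟ t ⌋ ∨ ⌊ i FinP.≟ t' ⌋) t | ≟-refl FinP._≟_ t = refl

lookup-pairʳ : ∀ {m} (t t' : Fin m) → Vec.lookup (pair t t') t' ≡ true
lookup-pairʳ t t' rewrite VecP.lookup∘tabulate (λ i → ⌊ i FinP.≟ t ⌋ ∨ ⌊ i FinP.≟ t' ⌋) t' | ≟-refl FinP._≟_ t'
  with ⌊ t' FinP.≟ t ⌋
... | true  = refl
... | false = refl

allEqOn-pair : {B : Set} (_≟_ : DecidableEquality B) {m : ℕ} (t t' : Fin m) (x : Vec B m) →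
               Vec.lookup x t ≡ Vec.lookup x t' → T (allEqOn _≟_ (pair t t') x)
allEqOn-pair _≟_ t t' x e = allEqOn-complete _≟_ (pair t t') x λ i i' i∈ i'∈ → equal (lookup-pair t t' i i∈) (lookup-pair t t' i' i'∈)
  where
    equal : ∀ {i i'} → i ≡ t ⊎ i ≡ t' → i' ≡ t ⊎ i' ≡ t' → Vec.lookup x i ≡ Vec.lookup x i'
    equal (inj₁ refl) (inj₁ refl) = refl
    equal (inj₁ refl) (inj₂ refl) = e
    equal (inj₂ refl) (inj₁ refl) = sym e
    equal (inj₂ refl) (inj₂ refl) = refl

¬allEqOn-pair : {B : Set} (_≟_ : DecidableEquality B) {m : ℕ} (t t' : Fin m) (b : Vec B m) →
                Vec.lookup b t ≢ Vec.lookup b t' → ¬ T (allEqOn _≟_ (pair t t') b)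
¬allEqOn-pair _≟_ t t' b b≢ holds = b≢ (allEqOn-sound _≟_ (pair t t') b holds t t' (lookup-pairˡ t t') (lookup-pairʳ t t'))

allEqOn-⊥ : {B : Set} (_≟_ : DecidableEquality B) {m : ℕ} (x : Vec B m) → T (allEqOn _≟_ Subset.⊥ x)
allEqOn-⊥ _≟_ x = allEqOn-complete _≟_ Subset.⊥ x λ i i' e _ → ⊥-elim (false≢true (trans (sym (VecP.lookup-replicate i false)) e))
  where
    false≢true : false ≢ true
    false≢true ()

T?-yes : ∀ {b} (t : T b) → T? b ≡ yes t
T?-yes {true} tt = refl

module StarCorrespondence {σ : Signature} (Fσ : FinSignature σ) (k : ℕ) (X A : Structure σ)
  (X-complete : ∀ y → y ∈ Structure.elems X) (X-unique : Unique (Structure.elems X))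
  (A-complete : ∀ a → a ∈ Structure.elems A) (A-unique : Unique (Structure.elems A)) where

  open Signature σ
  open FinSignature Fσ
  open StarDefs Fσ k
  module X = Structure X
  module A = Structure A
  module TX = TupleCoordinates X A X-complete X-unique A-complete A-unique
  module X* = StarUniverse Fσ k X X-complete X-unique
  module A* = StarUniverse Fσ k A A-complete A-unique
  module RX = StarRelations Fσ k X
  module RA = StarRelations Fσ k A
  module T* = TupleCoordinates (star X) (star A) X*.∈-elems* X*.elems*-unique A*.∈-elems* A*.elems*-unique

  _≟MA_ : DecidableEquality (Maybe (Star A))
  _≟MA_ = MaybeP.≡-dec (_≟*_ A)

  len≤k : ∀ (j : Fin k) → len j ≤ k
  len≤k = FinP.toℕ<n

  -- the second component d of the pairs (c , d) in T_{j,i}^{A*}, resp. R_i^{A*}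
  partnerTi : (j j' : Fin k) (is : Vec (Fin (len j)) (len j')) → Star A → Maybe (Star A)
  partnerTi j j' is (tup j₁ b) with j FinP.≟ j₁
  ... | yes refl = just (tup j' (proj is b))
  ... | no _     = nothing
  partnerTi j j' is (con _ _ _) = nothing

  partnerRi : (R : Sym) (j : Fin k) (is : Vec (Fin (ar R)) (len j)) → Star A → Maybe (Star A)
  partnerRi R j is (con R₁ a _) with R ≟S R₁
  ... | yes refl = just (tup j (proj is a))
  ... | no _     = nothing
  partnerRi R j is (tup _ _) = nothing

  partnerTi-tup : ∀ j j' is b → partnerTi j j' is (tup j b) ≡ just (tup j' (proj is b))
  partnerTi-tup j j' is b rewrite ≟-refl FinP._≟_ j = refl

  partnerRi-con : ∀ R j is a t → partnerRi R j is (con R a t) ≡ just (tup j (proj is a))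
  partnerRi-con R j is a t rewrite ≟-refl _≟S_ R = refl

  ∑-pick-singleton : (F : Star A → ℚ) (c₀ : Star A) → ∑ A*.elems* (λ c → when ((c ∷ []) T*.≟V (c₀ ∷ [])) (F c)) ≡ F c₀
  ∑-pick-singleton F c₀ =
    trans (∑-single A*.elems* A*.elems*-unique (A*.∈-elems* c₀)
                    (λ {c} _ c≢ → when-no ((c ∷ []) T*.≟V (c₀ ∷ [])) _ (c≢ ∘ VecP.∷-injectiveˡ)))
          (when-yes ((c₀ ∷ []) T*.≟V (c₀ ∷ [])) _ refl)

  ∑-pick : (d₀ : Star A) (q : ℚ) → ∑ A*.elems* (λ d → when (just d ≟MA just d₀) q) ≡ q
  ∑-pick d₀ q =
    trans (∑-single A*.elems* A*.elems*-unique (A*.∈-elems* d₀)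
                    (λ {d} _ d≢ → when-no (just d ≟MA just d₀) _ (d≢ ∘ just-injective)))
          (when-yes (just d₀ ≟MA just d₀) _ refl)

  consistent-singleton : ∀ (u : Star X) (c : Star A) → T*.Consistent (u ∷ []) (c ∷ [])
  consistent-singleton u c zero zero _ = refl

  -- The SA^1 solution on X^{*k}: the elements tup j x and R(x) of X^{*k} get μ x and ν R x, carried over
  -- to A^{*k}, and the binary constraints T_{j,i} and R_i get the distribution of (c , π_i c).
  module StarFromTuples (ts : TX.TupleSolution k) where
    open TX.TupleSolution ts

    p* : Star X → Star A → ℚ
    p* (tup j x) (tup j' b) with j FinP.≟ j'
    ... | yes refl = μ x b
    ... | no _     = 0ℚ
    p* (tup j x) (con _ _ _) = 0ℚ
    p* (con R x t) (con R' a t') with R ≟S R'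
    ... | yes refl = ν R x a
    ... | no _     = 0ℚ
    p* (con _ _ _) (tup _ _) = 0ℚ

    p*-tup : ∀ j x b → p* (tup j x) (tup j b) ≡ μ x b
    p*-tup j x b rewrite ≟-refl FinP._≟_ j = refl

    p*-con : ∀ R x t a t' → p* (con R x t) (con R a t') ≡ ν R x a
    p*-con R x t a t' rewrite ≟-refl _≟S_ R = refl

    p*-tup-elim : ∀ j x₀ c (P : ℚ → Set) → ((∀ b → c ≢ tup j b) → P 0ℚ) → (∀ b → c ≡ tup j b → P (μ x₀ b)) →
                  P (p* (tup j x₀) c)
    p*-tup-elim j x₀ (tup j' b) P P0 Pμ with j FinP.≟ j'
    ... | yes refl = Pμ b refl
    ... | no j≢j'  = P0 (λ b' e → j≢j' (sym (proj₁ (A*.tup-injective e))))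
    p*-tup-elim j x₀ (con R a t) P P0 Pμ = P0 (λ b ())

    p*-con-elim : ∀ R x₀ t₀ c (P : ℚ → Set) → ((∀ a t → c ≢ con R a t) → P 0ℚ) →
                  (∀ a t → c ≡ con R a t → P (ν R x₀ a)) →
                  P (p* (con R x₀ t₀) c)
    p*-con-elim R x₀ t₀ (con R' a t) P P0 Pν with R ≟S R'
    ... | yes refl = Pν a t refl
    ... | no R≢R'  = P0 (λ a' t' e → R≢R' (sym (proj₁ (A*.con-injective e))))
    p*-con-elim R x₀ t₀ (tup j b) P P0 Pν = P0 (λ a t ())

    p*-tup-only : ∀ j x₀ c → (∀ b → c ≢ tup j b) → p* (tup j x₀) c ≡ 0ℚ
    p*-tup-only j x₀ c c≢ = p*-tup-elim j x₀ c (_≡ 0ℚ) (λ _ → refl) (λ b e → ⊥-elim (c≢ b e))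

    p*-con-only : ∀ R x₀ t₀ c → (∀ a t → c ≢ con R a t) → p* (con R x₀ t₀) c ≡ 0ℚ
    p*-con-only R x₀ t₀ c c≢ = p*-con-elim R x₀ t₀ c (_≡ 0ℚ) (λ _ → refl) (λ a t e → ⊥-elim (c≢ a t e))

    p*-nonneg : ∀ u c → 0ℚ ≤ℚ p* u c
    p*-nonneg (tup j x)   c = p*-tup-elim j x c (0ℚ ≤ℚ_) (λ _ → ℚP.≤-refl) (λ b _ → μ-nonneg (s≤s z≤n) (len≤k j) x b)
    p*-nonneg (con R x t) c = p*-con-elim R x t c (0ℚ ≤ℚ_) (λ _ → ℚP.≤-refl) (λ a _ _ → ν-nonneg R x t a)

    p*-normalised : ∀ u → ∑ A*.elems* (p* u) ≡ 1ℚ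
    p*-normalised (tup j x₀) = begin
      ∑ A*.elems* (p* (tup j x₀))                              ≡⟨ A*.∑-elems*-tup (p* (tup j x₀)) j (p*-tup-only j x₀) ⟩
      ∑ (allVecs A.elems (len j)) (λ b → p* (tup j x₀) (tup j b)) ≡⟨ ∑-cong (allVecs A.elems (len j)) (p*-tup j x₀) ⟩
      ∑ (allVecs A.elems (len j)) (μ x₀)                       ≡⟨ μ-normalised (s≤s z≤n) (len≤k j) x₀ ⟩
      1ℚ                                                       ∎
      where open ≡-Reasoning
    p*-normalised (con R x₀ t₀) = begin
      ∑ A*.elems* (p* (con R x₀ t₀))  ≡⟨ A*.∑-elems*-con (p* (con R x₀ t₀)) R (ν R x₀) (p*-con R x₀ t₀)
                                                           (λ a ¬r → ν-respects R x₀ t₀ a (¬r ∘ proj₁)) (p*-con-only R x₀ t₀) ⟩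
      ∑ (allVecs A.elems (ar R)) (ν R x₀) ≡⟨ ν-normalised R x₀ t₀ ⟩
      1ℚ                                  ∎
      where open ≡-Reasoning

    μ* : ∀ {m} → Vec (Star X) m → Vec (Star A) m → ℚ
    μ* []          []          = 0ℚ
    μ* (u ∷ [])    (c ∷ [])    = p* u c
    μ* (u ∷ v ∷ w) (c ∷ d ∷ e) = 0ℚ

    ν* : ∀ S → Vec (Star X) (starAr S) → Vec (Star A) (starAr S) → ℚ
    ν* (TS j S)     (u ∷ [])     (c ∷ [])     = p* u c
    ν* (RS R S)     (u ∷ [])     (c ∷ [])     = p* u c
    ν* (Ti j j' is) (u ∷ v ∷ []) (c ∷ d ∷ []) = when (just d ≟MA partnerTi j j' is c) (p* u c)
    ν* (Ri R j is)  (u ∷ v ∷ []) (c ∷ d ∷ []) = when (just d ≟MA partnerRi R j is c) (p* u c)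

    μ*-nonneg : ∀ {m} → 1 ≤ m → m ≤ 1 → ∀ x b → 0ℚ ≤ℚ μ* {m} x b
    μ*-nonneg {suc zero}    _ _        (u ∷ []) (c ∷ []) = p*-nonneg u c
    μ*-nonneg {suc (suc m)} _ (s≤s ()) x        b

    μ*-normalised : ∀ {m} → 1 ≤ m → m ≤ 1 → ∀ x → ∑ (allVecs (starElems A) m) (μ* x) ≡ 1ℚ
    μ*-normalised {suc zero}    _ _        (u ∷ []) = trans (∑-allVecs-1 A*.elems* (μ* (u ∷ []))) (p*-normalised u)
    μ*-normalised {suc (suc m)} _ (s≤s ()) x

    μ*-consistent : ∀ {m} → 1 ≤ m → m ≤ 1 → ∀ x b → ¬ T*.Consistent {m} x b → μ* x b ≡ 0ℚ
    μ*-consistent {suc zero}    _ _        (u ∷ []) (c ∷ []) ¬c = ⊥-elim (¬c (consistent-singleton u c))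
    μ*-consistent {suc (suc m)} _ (s≤s ()) x        b        ¬c

    μ*-marginal : ∀ {m m'} → 1 ≤ m' → m' ≤ 1 → m ≤ 1 → ∀ (x : Vec (Star X) m) (is : Vec (Fin m) m') (c : Vec (Star A) m') →
                  μ* (proj is x) c ≡ ∑ (allVecs (starElems A) m) (λ b → when (proj is b T*.≟V c) (μ* x b))
    μ*-marginal {suc zero}    {suc zero}     _ _        _        (u ∷ []) (zero ∷ []) (c₀ ∷ []) =
      sym (trans (∑-allVecs-1 A*.elems* _) (∑-pick-singleton (p* u) c₀))
    μ*-marginal {zero}        {suc zero}     _ _        _        x (() ∷ []) c
    μ*-marginal {suc (suc m)} {_}            _ _        (s≤s ()) x is c
    μ*-marginal {_}           {suc (suc m')} _ (s≤s ()) _        x is c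

    allEqOn-transfer : ∀ {m} (S : Subset m) (x₀ : Vec X.U m) (b : Vec A.U m) →
                       T (allEqOn X._≟U_ S x₀) → TX.Consistent x₀ b → T (allEqOn A._≟U_ S b)
    allEqOn-transfer S x₀ b x₀-eq consistent =
      allEqOn-complete A._≟U_ S b (λ i i' i∈ i'∈ → consistent i i' (allEqOn-sound X._≟U_ S x₀ x₀-eq i i' i∈ i'∈))

    consistent-Ti : ∀ j j' (is : Vec (Fin (len j)) (len j')) x₀ b → TX.Consistent x₀ b →
                    T*.Consistent (tup j x₀ ∷ tup j' (proj is x₀) ∷ []) (tup j b ∷ tup j' (proj is b) ∷ [])
    consistent-Ti j j' is x₀ b cb zero       zero       e = refl
    consistent-Ti j j' is x₀ b cb (suc zero) (suc zero) e = refl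
    consistent-Ti j j' is x₀ b cb zero       (suc zero) e with X*.tup-injective e
    ... | refl , x₀≡ = cong (tup j) (fixed-by-proj x₀≡)
      where
        fixed-by-proj : x₀ ≡ proj is x₀ → b ≡ proj is b
        fixed-by-proj x₀≡ = lookup-ext λ t →
          trans (cb t (Vec.lookup is t) (trans (cong (λ z → Vec.lookup z t) x₀≡) (proj-lookup is x₀ t))) (sym (proj-lookup is b t))
    consistent-Ti j j' is x₀ b cb (suc zero) zero e with X*.tup-injective e
    ... | refl , x₀≡ = sym (consistent-Ti j j is x₀ b cb zero (suc zero) (sym e))

    consistent-Ri : ∀ R j (is : Vec (Fin (ar R)) (len j)) x₀ t₀ a t b →
                    T*.Consistent (con R x₀ t₀ ∷ tup j (proj is x₀) ∷ []) (con R a t ∷ tup j b ∷ [])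
    consistent-Ri R j is x₀ t₀ a t b zero       zero       e = refl
    consistent-Ri R j is x₀ t₀ a t b (suc zero) (suc zero) e = refl
    consistent-Ri R j is x₀ t₀ a t b zero       (suc zero) ()
    consistent-Ri R j is x₀ t₀ a t b (suc zero) zero       ()

    ν*-nonneg : ∀ S x → T (starRel X S x) → ∀ a → 0ℚ ≤ℚ ν* S x a
    ν*-nonneg (TS j S)     (u ∷ [])     t (c ∷ [])     = p*-nonneg u c
    ν*-nonneg (RS R S)     (u ∷ [])     t (c ∷ [])     = p*-nonneg u c
    ν*-nonneg (Ti j j' is) (u ∷ v ∷ []) t (c ∷ d ∷ []) = when-nonneg (just d ≟MA partnerTi j j' is c) (p*-nonneg u c)
    ν*-nonneg (Ri R j is)  (u ∷ v ∷ []) t (c ∷ d ∷ []) = when-nonneg (just d ≟MA partnerRi R j is c) (p*-nonneg u c)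

    ν*-respects : ∀ S x → T (starRel X S x) → ∀ a → ¬ (T (starRel A S a) × T*.Consistent x a) → ν* S x a ≡ 0ℚ
    ν*-respects (TS j S) (u ∷ []) t (c ∷ []) ¬sat with RX.TS-holds⁻ j S u t
    ... | x₀ , refl , x₀-eq = p*-tup-elim j x₀ c (_≡ 0ℚ) (λ _ → refl) λ { b refl →
      μ-consistent (s≤s z≤n) (len≤k j) x₀ b λ cb →
        ¬sat (subst T (sym (RA.TS-holds j S b)) (allEqOn-transfer S x₀ b x₀-eq cb) , consistent-singleton _ _) }
    ν*-respects (RS R S) (u ∷ []) t (c ∷ []) ¬sat with RX.RS-holds⁻ R S u t
    ... | x₀ , t₀ , refl , x₀-eq = p*-con-elim R x₀ t₀ c (_≡ 0ℚ) (λ _ → refl) λ { a t' refl →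
      ν-respects R x₀ t₀ a λ (_ , ca) →
        ¬sat (subst T (sym (RA.RS-holds R S a t')) (allEqOn-transfer S x₀ a x₀-eq ca) , consistent-singleton _ _) }
    ν*-respects (Ti j j' is) (u ∷ v ∷ []) t (c ∷ d ∷ []) ¬sat with RX.Ti-holds⁻ j j' is u v t
    ... | x₀ , refl , refl =
      p*-tup-elim j x₀ c (λ q → when (just d ≟MA partnerTi j j' is c) q ≡ 0ℚ) (λ _ → when-0 (just d ≟MA partnerTi j j' is c)) on-tup
      where
        on-tup : ∀ b → c ≡ tup j b → when (just d ≟MA partnerTi j j' is c) (μ x₀ b) ≡ 0ℚ
        on-tup b refl rewrite partnerTi-tup j j' is b = by-cases (just d ≟MA just (tup j' (proj is b)))
          where
            by-cases : (d? : Dec (just d ≡ just (tup j' (proj is b)))) → when d? (μ x₀ b) ≡ 0ℚ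
            by-cases (no _)  = refl
            by-cases (yes e) with just-injective e
            ... | refl = μ-consistent (s≤s z≤n) (len≤k j) x₀ b (λ cb → ¬sat (RA.Ti-holds j j' is b , consistent-Ti j j' is x₀ b cb))
    ν*-respects (Ri R j is) (u ∷ v ∷ []) t (c ∷ d ∷ []) ¬sat with RX.Ri-holds⁻ R j is u v t
    ... | x₀ , t₀ , refl , refl =
      p*-con-elim R x₀ t₀ c (λ q → when (just d ≟MA partnerRi R j is c) q ≡ 0ℚ) (λ _ → when-0 (just d ≟MA partnerRi R j is c)) on-con
      where
        on-con : ∀ a t' → c ≡ con R a t' → when (just d ≟MA partnerRi R j is c) (ν R x₀ a) ≡ 0ℚ
        on-con a t' refl rewrite partnerRi-con R j is a t' = by-cases (just d ≟MA just (tup j (proj is a)))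
          where
            by-cases : (d? : Dec (just d ≡ just (tup j (proj is a)))) → when d? (ν R x₀ a) ≡ 0ℚ
            by-cases (no _)  = refl
            by-cases (yes e) with just-injective e
            ... | refl = ⊥-elim (¬sat (RA.Ri-holds R j is a t' , consistent-Ri R j is x₀ t₀ a t' (proj is a)))

    graph-marginalˡ : (π : Star A → Maybe (Star A)) (q : Star A → ℚ) (F : Vec (Star A) 2 → ℚ) →
                     (∀ c d → F (c ∷ d ∷ []) ≡ when (just d ≟MA π c) (q c)) → ∀ c₀ →
                     ∑ A*.elems* (λ d → when (just d ≟MA π c₀) (q c₀)) ≡ q c₀ →
                     q c₀ ≡ ∑ (allVecs (starElems A) 2) (λ a → when (proj (zero ∷ []) a T*.≟V (c₀ ∷ [])) (F a))
    graph-marginalˡ π q F F≡ c₀ total = sym (begin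
      ∑ (allVecs (starElems A) 2) (λ a → when (proj (zero ∷ []) a T*.≟V (c₀ ∷ [])) (F a))
        ≡⟨ ∑-allVecs-2 A*.elems* _ ⟩
      ∑ A*.elems* (λ c → ∑ A*.elems* (λ d → when ((c ∷ []) T*.≟V (c₀ ∷ [])) (F (c ∷ d ∷ []))))
        ≡⟨ ∑-cong A*.elems* (λ c → ∑-cong A*.elems* (λ d → cong (when ((c ∷ []) T*.≟V (c₀ ∷ []))) (F≡ c d))) ⟩
      ∑ A*.elems* (λ c → ∑ A*.elems* (λ d → when ((c ∷ []) T*.≟V (c₀ ∷ [])) (when (just d ≟MA π c) (q c))))
        ≡⟨ ∑-cong A*.elems* (λ c → ∑-when A*.elems* ((c ∷ []) T*.≟V (c₀ ∷ [])) (λ d → when (just d ≟MA π c) (q c))) ⟩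
      ∑ A*.elems* (λ c → when ((c ∷ []) T*.≟V (c₀ ∷ [])) (∑ A*.elems* (λ d → when (just d ≟MA π c) (q c))))
        ≡⟨ ∑-pick-singleton (λ c → ∑ A*.elems* (λ d → when (just d ≟MA π c) (q c))) c₀ ⟩
      ∑ A*.elems* (λ d → when (just d ≟MA π c₀) (q c₀))
        ≡⟨ total ⟩
      q c₀ ∎)
      where open ≡-Reasoning

    graph-marginalʳ : (π : Star A → Maybe (Star A)) (q : Star A → ℚ) (F : Vec (Star A) 2 → ℚ) →
                      (∀ c d → F (c ∷ d ∷ []) ≡ when (just d ≟MA π c) (q c)) → ∀ d₀ →
                      ∑ (allVecs (starElems A) 2) (λ a → when (proj (suc zero ∷ []) a T*.≟V (d₀ ∷ [])) (F a))
                        ≡ ∑ A*.elems* (λ c → when (just d₀ ≟MA π c) (q c))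
    graph-marginalʳ π q F F≡ d₀ = trans (∑-allVecs-2 A*.elems* _) (∑-cong A*.elems* λ c →
      trans (∑-cong A*.elems* (λ d → cong (when ((d ∷ []) T*.≟V (d₀ ∷ []))) (F≡ c d)))
            (∑-pick-singleton (λ d → when (just d ≟MA π c) (q c)) d₀))

    partner-total : ∀ (π : Star A → Maybe (Star A)) {c} q → (∃ λ d₀ → π c ≡ just d₀) →
                    ∑ A*.elems* (λ d → when (just d ≟MA π c) q) ≡ q
    partner-total π q (d₀ , e) rewrite e = ∑-pick d₀ q

    partner-none : ∀ (π : Star A → Maybe (Star A)) c → ∑ A*.elems* (λ d → when (just d ≟MA π c) 0ℚ) ≡ 0ℚ
    partner-none π c = ∑-zero A*.elems* (λ {d} _ → when-0 (just d ≟MA π c))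

    Ti-marginal : ∀ j j' is x₀ c₀ →
                  p* (tup j' (proj is x₀)) c₀ ≡ ∑ A*.elems* (λ c → when (just c₀ ≟MA partnerTi j j' is c) (p* (tup j x₀) c))
    Ti-marginal j j' is x₀ c₀ = trans lhs (sym (trans (A*.∑-elems*-tup _ j off-tup) (∑-cong (allVecs A.elems (len j)) on-tup)))
      where
        rhs = ∑ (allVecs A.elems (len j)) (λ b → when (just c₀ ≟MA just (tup j' (proj is b))) (μ x₀ b))
        off-tup : ∀ c → (∀ b → c ≢ tup j b) → when (just c₀ ≟MA partnerTi j j' is c) (p* (tup j x₀) c) ≡ 0ℚ
        off-tup c c≢ = trans (cong (when (just c₀ ≟MA partnerTi j j' is c)) (p*-tup-only j x₀ c c≢))
                             (when-0 (just c₀ ≟MA partnerTi j j' is c))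
        on-tup : ∀ b → when (just c₀ ≟MA partnerTi j j' is (tup j b)) (p* (tup j x₀) (tup j b))
                       ≡ when (just c₀ ≟MA just (tup j' (proj is b))) (μ x₀ b)
        on-tup b rewrite partnerTi-tup j j' is b | p*-tup j x₀ b = refl
        lhs : p* (tup j' (proj is x₀)) c₀ ≡ rhs
        lhs = p*-tup-elim j' (proj is x₀) c₀ (_≡ rhs)
          (λ c₀≢ → sym (∑-zero (allVecs A.elems (len j)) (λ {b} _ →
            when-no (just c₀ ≟MA just (tup j' (proj is b))) _ (λ e → c₀≢ (proj is b) (just-injective e)))))
          (λ { b' refl → trans (μ-marginal (s≤s z≤n) (len≤k j') (len≤k j) x₀ is b')
                 (∑-cong (allVecs A.elems (len j)) (λ b → when-cong (proj is b TX.≟V b') (just (tup j' b') ≟MA just (tup j' (proj is b))) _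
                   (λ { refl → refl }) (λ e → sym (A*.tup-injectiveʳ (just-injective e))))) })

    Ri-marginal : ∀ R j is x₀ t₀ c₀ →
                  p* (tup j (proj is x₀)) c₀ ≡ ∑ A*.elems* (λ c → when (just c₀ ≟MA partnerRi R j is c) (p* (con R x₀ t₀) c))
    Ri-marginal R j is x₀ t₀ c₀ = trans lhs (sym (A*.∑-elems*-con _ R g on-con g-unsat off-con))
      where
        g : Vec A.U (ar R) → ℚ
        g a = when (just c₀ ≟MA just (tup j (proj is a))) (ν R x₀ a)
        on-con : ∀ a t' → when (just c₀ ≟MA partnerRi R j is (con R a t')) (p* (con R x₀ t₀) (con R a t')) ≡ g a
        on-con a t' rewrite partnerRi-con R j is a t' | p*-con R x₀ t₀ a t' = refl
        g-unsat : ∀ a → ¬ T (A.rel R a) → g a ≡ 0ℚ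
        g-unsat a ¬r = trans (cong (when (just c₀ ≟MA just (tup j (proj is a)))) (ν-respects R x₀ t₀ a (¬r ∘ proj₁)))
                             (when-0 (just c₀ ≟MA just (tup j (proj is a))))
        off-con : ∀ c → (∀ a t' → c ≢ con R a t') → when (just c₀ ≟MA partnerRi R j is c) (p* (con R x₀ t₀) c) ≡ 0ℚ
        off-con c c≢ = trans (cong (when (just c₀ ≟MA partnerRi R j is c)) (p*-con-only R x₀ t₀ c c≢))
                             (when-0 (just c₀ ≟MA partnerRi R j is c))
        lhs : p* (tup j (proj is x₀)) c₀ ≡ ∑ (allVecs A.elems (ar R)) g
        lhs = p*-tup-elim j (proj is x₀) c₀ (_≡ ∑ (allVecs A.elems (ar R)) g)
          (λ c₀≢ → sym (∑-zero (allVecs A.elems (ar R)) (λ {a} _ →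
            when-no (just c₀ ≟MA just (tup j (proj is a))) _ (λ e → c₀≢ (proj is a) (just-injective e)))))
          (λ { b' refl → trans (ν-marginal R x₀ t₀ (s≤s z≤n) (len≤k j) is b')
                 (∑-cong (allVecs A.elems (ar R)) (λ a → when-cong (proj is a TX.≟V b') (just (tup j b') ≟MA just (tup j (proj is a))) _
                   (λ { refl → refl }) (λ e → sym (A*.tup-injectiveʳ (just-injective e))))) })

    ν*-marginal : ∀ S x → T (starRel X S x) → ∀ {m'} → 1 ≤ m' → m' ≤ 1 → (is : Vec (Fin (starAr S)) m') (c : Vec (Star A) m') →
                  μ* (proj is x) c ≡ ∑ (allVecs (starElems A) (starAr S)) (λ a → when (proj is a T*.≟V c) (ν* S x a))
    ν*-marginal S x t {suc (suc _)} _ (s≤s ()) is c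
    ν*-marginal (TS j S) (u ∷ []) t {suc zero} _ _ (zero ∷ []) (c₀ ∷ []) =
      sym (trans (∑-allVecs-1 A*.elems* _) (∑-pick-singleton (p* u) c₀))
    ν*-marginal (RS R S) (u ∷ []) t {suc zero} _ _ (zero ∷ []) (c₀ ∷ []) =
      sym (trans (∑-allVecs-1 A*.elems* _) (∑-pick-singleton (p* u) c₀))
    ν*-marginal (Ti j j' is) (u ∷ v ∷ []) t {suc zero} _ _ (i ∷ []) (c₀ ∷ []) with RX.Ti-holds⁻ j j' is u v t
    ... | x₀ , refl , refl with i
    ...   | zero = graph-marginalˡ (partnerTi j j' is) (p* u) _ (λ c d → refl) c₀
                     (p*-tup-elim j x₀ c₀ (λ q → ∑ A*.elems* (λ d → when (just d ≟MA partnerTi j j' is c₀) q) ≡ q)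
                        (λ _ → partner-none (partnerTi j j' is) c₀)
                        (λ { b refl → partner-total (partnerTi j j' is) _ (_ , partnerTi-tup j j' is b) }))
    ...   | suc zero = trans (Ti-marginal j j' is x₀ c₀) (sym (graph-marginalʳ (partnerTi j j' is) (p* u) _ (λ c d → refl) c₀))
    ν*-marginal (Ri R j is) (u ∷ v ∷ []) t {suc zero} _ _ (i ∷ []) (c₀ ∷ []) with RX.Ri-holds⁻ R j is u v t
    ... | x₀ , t₀ , refl , refl with i
    ...   | zero = graph-marginalˡ (partnerRi R j is) (p* u) _ (λ c d → refl) c₀
                     (p*-con-elim R x₀ t₀ c₀ (λ q → ∑ A*.elems* (λ d → when (just d ≟MA partnerRi R j is c₀) q) ≡ q)
                        (λ _ → partner-none (partnerRi R j is) c₀)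
                        (λ { a t' refl → partner-total (partnerRi R j is) {con R a t'} _ (_ , partnerRi-con R j is a t') }))
    ...   | suc zero = trans (Ri-marginal R j is x₀ t₀ c₀) (sym (graph-marginalʳ (partnerRi R j is) (p* u) _ (λ c d → refl) c₀))

    position₀ : ∀ S → Fin (starAr S)
    position₀ (TS _ _)   = zero
    position₀ (Ti _ _ _) = zero
    position₀ (RS _ _)   = zero
    position₀ (Ri _ _ _) = zero

    ν*-normalised : ∀ S x → T (starRel X S x) → ∑ (allVecs (starElems A) (starAr S)) (ν* S x) ≡ 1ℚ
    ν*-normalised S x t = T*.normalised-from-marginal (ν* S x) (μ* (proj (i ∷ []) x)) i
      (ν*-marginal S x t (s≤s z≤n) ℕP.≤-refl (i ∷ [])) (μ*-normalised (s≤s z≤n) ℕP.≤-refl (proj (i ∷ []) x))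
      where i = position₀ S

    tupleSolution* : T*.TupleSolution 1
    tupleSolution* = record
      { μ = μ* ; ν = ν* ; μ-nonneg = μ*-nonneg ; μ-normalised = μ*-normalised ; μ-consistent = μ*-consistent
      ; μ-marginal = μ*-marginal ; ν-nonneg = ν*-nonneg ; ν-normalised = ν*-normalised ; ν-respects = ν*-respects
      ; ν-marginal = ν*-marginal }

  -- μ on X^m is read off the element tup j x of X^{*k} with len j = m; lengths outside [1, k] get 0.
  lengthIndex : (m : ℕ) → Maybe (Σ (Fin k) λ j → len j ≡ m)
  lengthIndex zero    = nothing
  lengthIndex (suc m) with m ℕP.<? k
  ... | yes m<k = just (fromℕ< m<k , cong suc (FinP.toℕ-fromℕ< m<k))
  ... | no _    = nothing

  lengthIndex-len : ∀ j → lengthIndex (len j) ≡ just (j , refl)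
  lengthIndex-len j with toℕ j ℕP.<? k
  ... | yes j<k = cong just (unique (fromℕ< j<k) _)
    where
      unique : ∀ j' (e : len j' ≡ len j) → _≡_ {A = Σ (Fin k) λ i → len i ≡ len j} (j' , e) (j , refl)
      unique j' e with FinP.toℕ-injective (ℕP.suc-injective e)
      ... | refl = cong (j ,_) (ℕP.≡-irrelevant e refl)
  ... | no j≮k = ⊥-elim (j≮k (FinP.toℕ<n j))

  by-len : ∀ {m} → 1 ≤ m → m ≤ k → (P : ℕ → Set) → (∀ (j : Fin k) → P (len j)) → P m
  by-len {suc m} _ m<k P P-len = subst P (cong suc (FinP.toℕ-fromℕ< m<k)) (P-len (fromℕ< m<k))

  module TuplesFromStar (ts* : T*.TupleSolution 1) where
    open T*.TupleSolution ts* using () renaming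
      ( μ to μ* ; ν to ν* ; μ-nonneg to μ*-nonneg ; μ-normalised to μ*-normalised ; ν-respects to ν*-respects
      ; ν-marginal to ν*-marginal )

    p* : Star X → Star A → ℚ
    p* u c = μ* (u ∷ []) (c ∷ [])

    p*-nonneg : ∀ u c → 0ℚ ≤ℚ p* u c
    p*-nonneg u c = μ*-nonneg (s≤s z≤n) ℕP.≤-refl (u ∷ []) (c ∷ [])

    p*-normalised : ∀ u → ∑ A*.elems* (p* u) ≡ 1ℚ
    p*-normalised u = trans (sym (∑-allVecs-1 A*.elems* (μ* (u ∷ [])))) (μ*-normalised (s≤s z≤n) ℕP.≤-refl (u ∷ []))

    p*-respects-TS : ∀ j S u c → T (starRel X (TS j S) (u ∷ [])) → ¬ T (starRel A (TS j S) (c ∷ [])) → p* u c ≡ 0ℚ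
    p*-respects-TS j S u c t ¬sat = begin
      p* u c
        ≡⟨ ν*-marginal (TS j S) (u ∷ []) t (s≤s z≤n) ℕP.≤-refl (zero ∷ []) (c ∷ []) ⟩
      ∑ (allVecs (starElems A) 1) _
        ≡⟨ ∑-allVecs-1 A*.elems* _ ⟩
      ∑ A*.elems* _
        ≡⟨ ∑-pick-singleton (λ c' → ν* (TS j S) (u ∷ []) (c' ∷ [])) c ⟩
      ν* (TS j S) (u ∷ []) (c ∷ [])
        ≡⟨ ν*-respects (TS j S) (u ∷ []) t (c ∷ []) (¬sat ∘ proj₁) ⟩
      0ℚ ∎
      where open ≡-Reasoning

    p*-respects-RS : ∀ R S u c → T (starRel X (RS R S) (u ∷ [])) → ¬ T (starRel A (RS R S) (c ∷ [])) → p* u c ≡ 0ℚ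
    p*-respects-RS R S u c t ¬sat = begin
      p* u c
        ≡⟨ ν*-marginal (RS R S) (u ∷ []) t (s≤s z≤n) ℕP.≤-refl (zero ∷ []) (c ∷ []) ⟩
      ∑ (allVecs (starElems A) 1) _
        ≡⟨ ∑-allVecs-1 A*.elems* _ ⟩
      ∑ A*.elems* _
        ≡⟨ ∑-pick-singleton (λ c' → ν* (RS R S) (u ∷ []) (c' ∷ [])) c ⟩
      ν* (RS R S) (u ∷ []) (c ∷ [])
        ≡⟨ ν*-respects (RS R S) (u ∷ []) t (c ∷ []) (¬sat ∘ proj₁) ⟩
      0ℚ ∎
      where open ≡-Reasoning

    -- T_{j,∅} and R_∅ hold exactly on the tuples of length len j, resp. on the constraints R(a)
    p*-tup-only : ∀ j x₀ c → (∀ b → c ≢ tup j b) → p* (tup j x₀) c ≡ 0ℚ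
    p*-tup-only j x₀ c c≢ =
      p*-respects-TS j Subset.⊥ (tup j x₀) c (subst T (sym (RX.TS-holds j Subset.⊥ x₀)) (allEqOn-⊥ X._≟U_ x₀))
        (λ sat → let b , c≡ , _ = RA.TS-holds⁻ j Subset.⊥ c sat in c≢ b c≡)

    p*-con-only : ∀ R x₀ t₀ c → (∀ a t → c ≢ con R a t) → p* (con R x₀ t₀) c ≡ 0ℚ
    p*-con-only R x₀ t₀ c c≢ =
      p*-respects-RS R Subset.⊥ (con R x₀ t₀) c (subst T (sym (RX.RS-holds R Subset.⊥ x₀ t₀)) (allEqOn-⊥ X._≟U_ x₀))
        (λ sat → let a , t , c≡ , _ = RA.RS-holds⁻ R Subset.⊥ c sat in c≢ a t c≡)

    pair-marginalˡ : ∀ (G : Vec (Star A) 2 → ℚ) u c₁ →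
                   p* u c₁ ≡ ∑ (allVecs (starElems A) 2) (λ a → when (proj (zero ∷ []) a T*.≟V (c₁ ∷ [])) (G a)) →
                   p* u c₁ ≡ ∑ A*.elems* (λ d → G (c₁ ∷ d ∷ []))
    pair-marginalˡ G u c₁ marginal = begin
      p* u c₁
        ≡⟨ marginal ⟩
      ∑ (allVecs (starElems A) 2) (λ a → when (proj (zero ∷ []) a T*.≟V (c₁ ∷ [])) (G a))
        ≡⟨ ∑-allVecs-2 A*.elems* _ ⟩
      ∑ A*.elems* (λ c → ∑ A*.elems* (λ d → when ((c ∷ []) T*.≟V (c₁ ∷ [])) (G (c ∷ d ∷ []))))
        ≡⟨ ∑-cong A*.elems* (λ c → ∑-when A*.elems* ((c ∷ []) T*.≟V (c₁ ∷ [])) (λ d → G (c ∷ d ∷ []))) ⟩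
      ∑ A*.elems* (λ c → when ((c ∷ []) T*.≟V (c₁ ∷ [])) (∑ A*.elems* (λ d → G (c ∷ d ∷ []))))
        ≡⟨ ∑-pick-singleton (λ c → ∑ A*.elems* (λ d → G (c ∷ d ∷ []))) c₁ ⟩
      ∑ A*.elems* (λ d → G (c₁ ∷ d ∷ [])) ∎
      where open ≡-Reasoning

    pair-marginalʳ : ∀ (G : Vec (Star A) 2 → ℚ) v d₁ →
                    p* v d₁ ≡ ∑ (allVecs (starElems A) 2) (λ a → when (proj (suc zero ∷ []) a T*.≟V (d₁ ∷ [])) (G a)) →
                    p* v d₁ ≡ ∑ A*.elems* (λ c → G (c ∷ d₁ ∷ []))
    pair-marginalʳ G v d₁ marginal =
      trans marginal (trans (∑-allVecs-2 A*.elems* _) (∑-cong A*.elems* (λ c → ∑-pick-singleton (λ d → G (c ∷ d ∷ [])) d₁)))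

    μ-at : ∀ m → Vec X.U m → Vec A.U m → Maybe (Σ (Fin k) λ j → len j ≡ m) → ℚ
    μ-at m x b nothing        = 0ℚ
    μ-at m x b (just (j , e)) = p* (tup j (subst (Vec X.U) (sym e) x)) (tup j (subst (Vec A.U) (sym e) b))

    μ : ∀ {m} → Vec X.U m → Vec A.U m → ℚ
    μ {m} x b = μ-at m x b (lengthIndex m)

    μ-len : ∀ (j : Fin k) x b → μ {len j} x b ≡ p* (tup j x) (tup j b)
    μ-len j x b = cong (μ-at (len j) x b) (lengthIndex-len j)

    ν-at : ∀ R (x : Vec X.U (ar R)) (a : Vec A.U (ar R)) → Dec (T (X.rel R x)) → Dec (T (A.rel R a)) → ℚ
    ν-at R x a (yes t) (yes t') = p* (con R x t) (con R a t')
    ν-at R x a (yes t) (no _)   = 0ℚ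
    ν-at R x a (no _)  _        = 0ℚ

    ν : ∀ R → Vec X.U (ar R) → Vec A.U (ar R) → ℚ
    ν R x a = ν-at R x a (T? (X.rel R x)) (T? (A.rel R a))

    ν-con : ∀ R x t a t' → ν R x a ≡ p* (con R x t) (con R a t')
    ν-con R x t a t' rewrite T?-yes {X.rel R x} t | T?-yes {A.rel R a} t' = refl

    ν-unsat : ∀ R x a → ¬ T (A.rel R a) → ν R x a ≡ 0ℚ
    ν-unsat R x a ¬r with T? (X.rel R x) | T? (A.rel R a)
    ... | yes _ | yes r = ⊥-elim (¬r r)
    ... | yes _ | no _  = refl
    ... | no _  | _     = refl

    μ-nonneg : ∀ {m} → 1 ≤ m → m ≤ k → ∀ x b → 0ℚ ≤ℚ μ {m} x b
    μ-nonneg 1≤ ≤k = by-len 1≤ ≤k (λ m → ∀ (x : Vec X.U m) b → 0ℚ ≤ℚ μ x b)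
      (λ j x b → subst (0ℚ ≤ℚ_) (sym (μ-len j x b)) (p*-nonneg _ _))

    μ-normalised : ∀ {m} → 1 ≤ m → m ≤ k → ∀ x → ∑ (allVecs A.elems m) (μ x) ≡ 1ℚ
    μ-normalised 1≤ ≤k = by-len 1≤ ≤k (λ m → ∀ (x : Vec X.U m) → ∑ (allVecs A.elems m) (μ x) ≡ 1ℚ) λ j x → begin
      ∑ (allVecs A.elems (len j)) (μ x)                         ≡⟨ ∑-cong (allVecs A.elems (len j)) (μ-len j x) ⟩
      ∑ (allVecs A.elems (len j)) (λ b → p* (tup j x) (tup j b)) ≡⟨ A*.∑-elems*-tup (p* (tup j x)) j (p*-tup-only j x) ⟨
      ∑ A*.elems* (p* (tup j x))                                ≡⟨ p*-normalised (tup j x) ⟩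
      1ℚ                                                        ∎
      where open ≡-Reasoning

    -- an inconsistency b_t ≠ b_t' with x_t = x_t' violates T_{j,{t,t'}}
    μ-consistent : ∀ {m} → 1 ≤ m → m ≤ k → ∀ x → TX.VanishesOffConsistent {m} x (μ x)
    μ-consistent 1≤ ≤k = by-len 1≤ ≤k (λ m → ∀ (x : Vec X.U m) → TX.VanishesOffConsistent x (μ x)) λ j x b ¬c →
      let t , t' , x≡ , b≢ = inconsistency-witness X._≟U_ A._≟U_ x b ¬c in
      trans (μ-len j x b)
            (p*-respects-TS j (pair t t') (tup j x) (tup j b) (subst T (sym (RX.TS-holds j _ x)) (allEqOn-pair X._≟U_ t t' x x≡))
                            (¬allEqOn-pair A._≟U_ t t' b b≢ ∘ subst T (RA.TS-holds j _ b)))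

    μ-marginal-len : ∀ (j j' : Fin k) (x : Vec X.U (len j)) (is : Vec (Fin (len j)) (len j')) (c : Vec A.U (len j')) →
                     μ (proj is x) c ≡ ∑ (allVecs A.elems (len j)) (λ b → when (proj is b TX.≟V c) (μ x b))
    μ-marginal-len j j' x is c = begin
      μ (proj is x) c
        ≡⟨ μ-len j' (proj is x) c ⟩
      p* v (tup j' c)
        ≡⟨ pair-marginalʳ G v (tup j' c) 
             (ν*-marginal S (u ∷ v ∷ []) holds (s≤s z≤n) ℕP.≤-refl (suc zero ∷ []) (tup j' c ∷ [])) ⟩
      ∑ A*.elems* (λ c₁ → G (c₁ ∷ tup j' c ∷ []))
        ≡⟨ A*.∑-elems*-tup (λ c₁ → G (c₁ ∷ tup j' c ∷ [])) j off-block ⟩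
      ∑ (allVecs A.elems (len j)) (λ b → G (tup j b ∷ tup j' c ∷ []))
        ≡⟨ ∑-cong (allVecs A.elems (len j)) on-block ⟩
      ∑ (allVecs A.elems (len j)) (λ b → when (proj is b TX.≟V c) (μ x b)) ∎
      where
        open ≡-Reasoning
        S = Ti j j' is
        u = tup j x
        v = tup j' (proj is x)
        holds : T (starRel X S (u ∷ v ∷ []))
        holds = RX.Ti-holds j j' is x
        G : Vec (Star A) 2 → ℚ
        G = ν* S (u ∷ v ∷ [])
        G-unsat : ∀ c₁ d → ¬ T (starRel A S (c₁ ∷ d ∷ [])) → G (c₁ ∷ d ∷ []) ≡ 0ℚ
        G-unsat c₁ d ¬sat = ν*-respects S (u ∷ v ∷ []) holds (c₁ ∷ d ∷ []) (¬sat ∘ proj₁)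
        off-block : ∀ c₁ → (∀ b → c₁ ≢ tup j b) → G (c₁ ∷ tup j' c ∷ []) ≡ 0ℚ
        off-block c₁ c₁≢ = G-unsat c₁ _ (λ sat → let b , c₁≡ , _ = RA.Ti-holds⁻ j j' is c₁ _ sat in c₁≢ b c₁≡)
        on-block : ∀ b → G (tup j b ∷ tup j' c ∷ []) ≡ when (proj is b TX.≟V c) (μ x b)
        on-block b = by-cases (proj is b TX.≟V c)
          where
            by-cases : (d : Dec (proj is b ≡ c)) → G (tup j b ∷ tup j' c ∷ []) ≡ when d (μ x b)
            by-cases (no πb≢c) = G-unsat (tup j b) (tup j' c) λ sat →
              let _ , b≡ , c≡ = RA.Ti-holds⁻ j j' is (tup j b) (tup j' c) sat in
              πb≢c (trans (cong (proj is) (A*.tup-injectiveʳ b≡)) (sym (A*.tup-injectiveʳ c≡)))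
            by-cases (yes refl) = sym (begin
              μ x b
                ≡⟨ μ-len j x b ⟩
              p* u (tup j b)
                ≡⟨ pair-marginalˡ G u (tup j b) 
                     (ν*-marginal S (u ∷ v ∷ []) holds (s≤s z≤n) ℕP.≤-refl (zero ∷ []) (tup j b ∷ [])) ⟩
              ∑ A*.elems* (λ d → G (tup j b ∷ d ∷ []))
                ≡⟨ ∑-single A*.elems* A*.elems*-unique (A*.∈-elems* (tup j' (proj is b))) other-partner ⟩
              G (tup j b ∷ tup j' (proj is b) ∷ []) ∎)
              where
                other-partner : ∀ {d} → d ∈ A*.elems* → d ≢ tup j' (proj is b) → G (tup j b ∷ d ∷ []) ≡ 0ℚ
                other-partner {d} _ d≢ = G-unsat _ d λ sat →
                  let _ , b≡ , d≡ = RA.Ti-holds⁻ j j' is _ _ sat in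
                  d≢ (trans d≡ (cong (λ w → tup j' (proj is w)) (sym (A*.tup-injectiveʳ b≡))))

    μ-marginal : ∀ {m m'} → 1 ≤ m' → m' ≤ k → m ≤ k → ∀ (x : Vec X.U m) (is : Vec (Fin m) m') (c : Vec A.U m') →
                 μ (proj is x) c ≡ ∑ (allVecs A.elems m) (λ b → when (proj is b TX.≟V c) (μ x b))
    μ-marginal {zero}  {zero}  ()  _  _  x is       c
    μ-marginal {zero}  {suc _} _   _  _  x (() ∷ _) c
    μ-marginal {suc m} {m'}    1≤ ≤k ≤k' =
      by-len (s≤s z≤n) ≤k' (λ m → ∀ (x : Vec X.U m) (is : Vec (Fin m) m') c → Marginal x is c) λ j →
        by-len 1≤ ≤k (λ m' → ∀ (x : Vec X.U (len j)) (is : Vec (Fin (len j)) m') c → Marginal x is c) (μ-marginal-len j)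
      where
        Marginal : ∀ {m m'} → Vec X.U m → Vec (Fin m) m' → Vec A.U m' → Set
        Marginal {m} x is c = μ (proj is x) c ≡ ∑ (allVecs A.elems m) (λ b → when (proj is b TX.≟V c) (μ x b))

    ν-nonneg : ∀ R x → T (X.rel R x) → ∀ a → 0ℚ ≤ℚ ν R x a
    ν-nonneg R x t a with T? (X.rel R x) | T? (A.rel R a)
    ... | yes _ | yes _ = p*-nonneg _ _
    ... | yes _ | no _  = ℚP.≤-refl
    ... | no _  | _     = ℚP.≤-refl

    ν-normalised : ∀ R x → T (X.rel R x) → ∑ (allVecs A.elems (ar R)) (ν R x) ≡ 1ℚ
    ν-normalised R x t =
      trans (sym (A*.∑-elems*-con (p* (con R x t)) R (ν R x) (λ a t' → sym (ν-con R x t a t')) (ν-unsat R x) (p*-con-only R x t)))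
            (p*-normalised (con R x t))

    -- an inconsistency of a with x violates R_{{t,t'}}
    ν-respects : ∀ R x → T (X.rel R x) → ∀ a → ¬ (T (A.rel R a) × TX.Consistent x a) → ν R x a ≡ 0ℚ
    ν-respects R x t a ¬sat = by-cases (T? (A.rel R a))
      where
        by-cases : Dec (T (A.rel R a)) → ν R x a ≡ 0ℚ
        by-cases (no ¬r) = ν-unsat R x a ¬r
        by-cases (yes r) =
          let t₁ , t₂ , x≡ , a≢ = inconsistency-witness X._≟U_ A._≟U_ x a (λ c → ¬sat (r , c)) in
          trans (ν-con R x t a r)
                (p*-respects-RS R (pair t₁ t₂) (con R x t) (con R a r)
                                (subst T (sym (RX.RS-holds R _ x t)) (allEqOn-pair X._≟U_ t₁ t₂ x x≡))
                                (¬allEqOn-pair A._≟U_ t₁ t₂ a a≢ ∘ subst T (RA.RS-holds R _ a r)))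

    ν-marginal-len : ∀ R x (t : T (X.rel R x)) (j : Fin k) (is : Vec (Fin (ar R)) (len j)) (c : Vec A.U (len j)) →
                     μ (proj is x) c ≡ ∑ (allVecs A.elems (ar R)) (λ a → when (proj is a TX.≟V c) (ν R x a))
    ν-marginal-len R x t j is c = begin
      μ (proj is x) c
        ≡⟨ μ-len j (proj is x) c ⟩
      p* v (tup j c)
        ≡⟨ pair-marginalʳ G v (tup j c) 
             (ν*-marginal S (u ∷ v ∷ []) holds (s≤s z≤n) ℕP.≤-refl (suc zero ∷ []) (tup j c ∷ [])) ⟩
      ∑ A*.elems* (λ c₁ → G (c₁ ∷ tup j c ∷ []))
        ≡⟨ A*.∑-elems*-con (λ c₁ → G (c₁ ∷ tup j c ∷ [])) R g on-con g-unsat off-con ⟩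
      ∑ (allVecs A.elems (ar R)) g ∎
      where
        open ≡-Reasoning
        S = Ri R j is
        u = con R x t
        v = tup j (proj is x)
        holds : T (starRel X S (u ∷ v ∷ []))
        holds = RX.Ri-holds R j is x t
        G : Vec (Star A) 2 → ℚ
        G = ν* S (u ∷ v ∷ [])
        G-unsat : ∀ c₁ d → ¬ T (starRel A S (c₁ ∷ d ∷ [])) → G (c₁ ∷ d ∷ []) ≡ 0ℚ
        G-unsat c₁ d ¬sat = ν*-respects S (u ∷ v ∷ []) holds (c₁ ∷ d ∷ []) (¬sat ∘ proj₁)
        g : Vec A.U (ar R) → ℚ
        g a = when (proj is a TX.≟V c) (ν R x a)
        g-unsat : ∀ a → ¬ T (A.rel R a) → g a ≡ 0ℚ
        g-unsat a ¬r = trans (cong (when (proj is a TX.≟V c)) (ν-unsat R x a ¬r)) (when-0 (proj is a TX.≟V c))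
        off-con : ∀ c₁ → (∀ a t' → c₁ ≢ con R a t') → G (c₁ ∷ tup j c ∷ []) ≡ 0ℚ
        off-con c₁ c₁≢ = G-unsat c₁ _ (λ sat → let a , t' , c₁≡ , _ = RA.Ri-holds⁻ R j is c₁ _ sat in c₁≢ a t' c₁≡)
        on-con : ∀ a t' → G (con R a t' ∷ tup j c ∷ []) ≡ g a
        on-con a t' = by-cases (proj is a TX.≟V c)
          where
            by-cases : (d : Dec (proj is a ≡ c)) → G (con R a t' ∷ tup j c ∷ []) ≡ when d (ν R x a)
            by-cases (no πa≢c) = G-unsat (con R a t') (tup j c) λ sat →
              let _ , _ , a≡ , c≡ = RA.Ri-holds⁻ R j is (con R a t') (tup j c) sat in
              πa≢c (trans (cong (proj is) (A*.con-injectiveʳ a≡)) (sym (A*.tup-injectiveʳ c≡)))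
            by-cases (yes refl) = sym (begin
              ν R x a
                ≡⟨ ν-con R x t a t' ⟩
              p* u (con R a t')
                ≡⟨ pair-marginalˡ G u (con R a t') 
                     (ν*-marginal S (u ∷ v ∷ []) holds (s≤s z≤n) ℕP.≤-refl (zero ∷ []) (con R a t' ∷ [])) ⟩
              ∑ A*.elems* (λ d → G (con R a t' ∷ d ∷ []))
                ≡⟨ ∑-single A*.elems* A*.elems*-unique (A*.∈-elems* (tup j (proj is a))) other-partner ⟩
              G (con R a t' ∷ tup j (proj is a) ∷ []) ∎)
              where
                other-partner : ∀ {d} → d ∈ A*.elems* → d ≢ tup j (proj is a) → G (con R a t' ∷ d ∷ []) ≡ 0ℚ
                other-partner {d} _ d≢ = G-unsat _ d λ sat →
                  let _ , _ , a≡ , d≡ = RA.Ri-holds⁻ R j is _ _ sat in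
                  d≢ (trans d≡ (cong (λ w → tup j (proj is w)) (sym (A*.con-injectiveʳ a≡))))

    ν-marginal : ∀ R x → T (X.rel R x) → ∀ {m'} → 1 ≤ m' → m' ≤ k → (is : Vec (Fin (ar R)) m') (c : Vec A.U m') →
                 μ (proj is x) c ≡ ∑ (allVecs A.elems (ar R)) (λ a → when (proj is a TX.≟V c) (ν R x a))
    ν-marginal R x t 1≤ ≤k = by-len 1≤ ≤k
      (λ m' → ∀ (is : Vec (Fin (ar R)) m') c →
              μ (proj is x) c ≡ ∑ (allVecs A.elems (ar R)) (λ a → when (proj is a TX.≟V c) (ν R x a)))
      (ν-marginal-len R x t)

    tupleSolution : TX.TupleSolution k
    tupleSolution = record
      { μ = μ ; ν = ν ; μ-nonneg = μ-nonneg ; μ-normalised = μ-normalised ; μ-consistent = μ-consistent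
      ; μ-marginal = μ-marginal ; ν-nonneg = ν-nonneg ; ν-normalised = ν-normalised ; ν-respects = ν-respects
      ; ν-marginal = ν-marginal }


lemma7p3 : (σ : Signature) (Fσ : FinSignature σ) (X A : Structure σ) →
           IsFinStructure X → IsFinStructure A →
           (k : ℕ) → 1 ≤ k →
           SA-feasible k X A ⇔ SA-feasible 1 (starStructure Fσ k X) (starStructure Fσ k A)
lemma7p3 σ Fσ X A FX FA k 1≤k = mk⇔ to from
  where
    open IsFinStructure FX renaming (elems-complete to X-complete; elems-unique to X-unique)
    open IsFinStructure FA renaming (elems-complete to A-complete; elems-unique to A-unique; rel-nonempty to A-nonempty)
    open StarDefs Fσ k using (starAr; starRel; TS; Ti; RS; Ri)
    open StarCorrespondence Fσ k X A X-complete X-unique A-complete A-unique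

    no-nullary* : ∀ S → starAr S ≡ 0 → ∃ λ a → T (starRel A S a)
    no-nullary* (TS _ _)   ()
    no-nullary* (Ti _ _ _) ()
    no-nullary* (RS _ _)   ()
    no-nullary* (Ri _ _ _) ()

    to : SA-feasible k X A → SA-feasible 1 (starStructure Fσ k X) (starStructure Fσ k A)
    to = T*.SolutionFromTuples.solution ∘ StarFromTuples.tupleSolution*
       ∘ TX.TuplesFromSolution.tupleSolution 1≤k (λ R _ → A-nonempty R)

    from : SA-feasible 1 (starStructure Fσ k X) (starStructure Fσ k A) → SA-feasible k X A
    from = TX.SolutionFromTuples.solution ∘ TuplesFromStar.tupleSolution
         ∘ T*.TuplesFromSolution.tupleSolution ℕP.≤-refl no-nullary*
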